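{- Let $k>5$ be an integer, $w_k=\Big(\prod_{i=2}^{k-1}{\tt a}{\tt b}^i{\tt a}{\tt a}\cdot{\tt a}{\tt b}^i{\tt a}{\tt b}{\tt a}^{i-2}\Big)\cdot{\tt a}{\tt b}^k{\tt a}$, let $\widehat{w_k}$ be $w_k$ with its last character removed, and write $\beta(x)=\beta(x,\widehat{w_k}{\tt b})$. Then $\beta({\tt a}^i{\tt b})={\tt b}{\tt a}^{k-i-2}$ for all $4\le i\le k-2$; $\beta({\tt a}^3{\tt b})={\tt b}^5({\tt a}{\tt b})^{k-6}{\tt a}$; $\beta({\tt a}^2{\tt b})={\tt a}{\tt a}{\tt b}{\tt a}^{2k-8}$; $\beta({\tt a}{\tt b})={\tt b}^{k-2}{\tt b}{\tt a}{\tt b}{\tt a}^{2k-6}$; $\beta({\tt b}{\tt a})={\tt a}^{k-5}{\tt b}{\tt b}{\tt b}{\tt a}{\tt b}^{k-5}{\tt a}{\tt b}^{k-2}{\tt b}{\tt a}$; $\beta({\tt b}^j{\tt a})={\tt a}{\tt b}^{2k-2j-2}{\tt a}{\tt b}$ for all $2\le j\le k-1$; $\beta({\tt b}^k{\tt a})={\tt b}$; and $\beta({\tt b}^{k+1}{\tt a})={\tt a}$. Hence $\mathrm{BWT}(\widehat{w_k}{\tt b})=\prod_{i=2}^{k-1}\beta({\tt a}^{k-i}{\tt b})\cdot\prod_{i=1}^{k+1}\beta({\tt b}^i{\tt a})$, and $r(\widehat{w_k}{\tt b})=8k-20$.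
   Context: Alphabet $\{{\tt a},{\tt b}\}$ with ${\tt a}<{\tt b}$; $\prod$ is concatenation in increasing index order. For a word $w$ of length $n$, $\mathrm{BWT}(w)$ is obtained by sorting the conjugates $w[i..n-1]w[0..i-1]$ lexicographically and concatenating their last characters; $r(w)$ is the number of maximal equal-letter runs of $\mathrm{BWT}(w)$. For words $x,w$, $\beta(x,w)$ is the factor of $\mathrm{BWT}(w)$ formed by the last characters of the conjugates of $w$ having $x$ as a prefix (a contiguous range in sorted order). -}

module Defs where

open import Data.Nat using (ℕ; zero; suc; _+_; _∸_)
open import Data.List using (List; []; _∷_; _++_; map; concat; length; drop; take; filter)
open import Data.List using (upTo)
open import Data.Bool using (Bool; true; false; _∧_; _∨_; if_then_else_)

data Letter : Set where
  𝕒 𝕓 : Letter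

Word : Set
Word = List Letter

_==ᴸ_ : Letter → Letter → Bool
𝕒 ==ᴸ 𝕒 = true
𝕓 ==ᴸ 𝕓 = true
_ ==ᴸ _ = false

_<ᴸ_ : Letter → Letter → Bool
𝕒 <ᴸ 𝕓 = true
_ <ᴸ _ = false

lexLeq : Word → Word → Bool
lexLeq [] _ = true
lexLeq (_ ∷ _) [] = false
lexLeq (x ∷ u) (y ∷ v) = (x <ᴸ y) ∨ ((x ==ᴸ y) ∧ lexLeq u v)

insert : Word → List Word → List Word
insert u [] = u ∷ []
insert u (v ∷ vs) = if lexLeq u v then u ∷ v ∷ vs else v ∷ insert u vs

sortWords : List Word → List Word
sortWords [] = []
sortWords (u ∷ us) = insert u (sortWords us)

rotate : ℕ → Word → Word
rotate i w = drop i w ++ take i w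

conjugates : Word → List Word
conjugates w = map (λ i → rotate i w) (upTo (length w))

-- Last character of a word (only applied to nonempty words; default 𝕒).
lastOr : Letter → Word → Letter
lastOr d [] = d
lastOr d (x ∷ u) = lastOr x u

BWT : Word → Word
BWT w = map (lastOr 𝕒) (sortWords (conjugates w))

isPrefix : Word → Word → Bool
isPrefix [] _ = true
isPrefix (_ ∷ _) [] = false
isPrefix (x ∷ u) (y ∷ v) = (x ==ᴸ y) ∧ isPrefix u v

-- β(x, w): last characters of the conjugates of w having x as a prefix,
-- in sorted order (this is a contiguous range of BWT(w)).
β : Word → Word → Word
β x w = map (lastOr 𝕒) (filterB (isPrefix x) (sortWords (conjugates w)))
  where
  filterB : (Word → Bool) → List Word → List Word
  filterB p [] = []
  filterB p (u ∷ us) = if p u then u ∷ filterB p us else filterB p us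

runs : Word → ℕ
runs [] = 0
runs (x ∷ []) = 1
runs (x ∷ y ∷ u) = (if x ==ᴸ y then 0 else 1) + runs (y ∷ u)

r : Word → ℕ
r w = runs (BWT w)

pow : Word → ℕ → Word
pow u zero = []
pow u (suc n) = u ++ pow u n

_^ᴸ_ : Letter → ℕ → Word
c ^ᴸ n = pow (c ∷ []) n

-- prod m len f = f m · f (m+1) · … · f (m+len-1)   (concatenation, increasing index).
-- So ∏_{i=m}^{n} f i = prod m (n + 1 ∸ m) f.
prod : ℕ → ℕ → (ℕ → Word) → Word
prod m zero f = []
prod m (suc len) f = f m ++ prod (suc m) len f

w : ℕ → Word
w k = prod 2 (k ∸ 2) (λ i → (𝕒 ∷ (𝕓 ^ᴸ i)) ++ (𝕒 ∷ 𝕒 ∷ [])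
                         ++ (𝕒 ∷ (𝕓 ^ᴸ i)) ++ (𝕒 ∷ 𝕓 ∷ (𝕒 ^ᴸ (i ∸ 2))))
      ++ (𝕒 ∷ (𝕓 ^ᴸ k)) ++ (𝕒 ∷ [])

dropLast : Word → Word
dropLast [] = []
dropLast (x ∷ []) = []
dropLast (x ∷ y ∷ u) = x ∷ dropLast (y ∷ u)

ŵb : ℕ → Word
ŵb k = dropLast (w k) ++ (𝕓 ∷ [])

-- The conjugates of ŵb k are handled through the runs of the word.  A conjugate
-- starting j letters into a run c^m begins with c^(m-j) c̄, so it lies in the class
-- of the prefix c^(m-j) c̄, and its last letter is c unless j = 0, when it is the
-- letter of the preceding run.  Such a conjugate is described by a key: its first
-- (truncated) run, the four runs after it, and its last letter.  For ŵb k any two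
-- conjugates of one class are already ordered by their keys, so each class is sorted
-- by exhibiting a permutation of its keys that is a chain of these decisive
-- comparisons, and β is read off from the last letters.  The class prefixes
-- a^(k-2)b, …, ab, ba, …, b^(k+1)a are pairwise incomparable, increase
-- lexicographically and cover every conjugate, so the BWT is the concatenation of the
-- classes; r is then a count of letter changes in the explicit β-words.

module Submission where

open import Defs
open import Data.Bool using (Bool; true; false; _∧_; if_then_else_; not; T; T?)
open import Data.Empty using (⊥; ⊥-elim)
open import Data.List using (List; []; _∷_; _++_; map; length; drop; take; upTo; applyUpTo; filterᵇ; concat; concatMap)
open import Data.List.Properties
  using (++-assoc; ++-identityʳ; map-++; map-∘; length-++; map-applyUpTo; take++drop≡id; filter-++; filter-all; filter-none;
         filter-accept; filter-reject; map-cong-local; map-concatMap; concatMap-cong; concatMap-++)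
open import Data.List.Relation.Binary.Permutation.Propositional
  using (_↭_; ↭-sym; ↭-trans; ↭-refl; ↭-reflexive; prep; swap; ↭⇒↭ₛ)
open import Data.List.Relation.Binary.Permutation.Propositional.Properties
  using (map⁺; ↭-map-inv; All-resp-↭; filter-↭; shift; shifts; ++⁺ˡ; ++⁺ʳ; ++-comm; ∷↭∷ʳ)
open import Data.List.Relation.Binary.Pointwise using (Pointwise-≡⇒≡)
open import Data.List.Relation.Unary.All as All using (All; []; _∷_)
open import Data.List.Relation.Unary.All.Properties as Allₚ using (++⁺; map⁻; filter⁺; applyUpTo⁺₁; applyUpTo⁺₂)
open import Data.List.Relation.Unary.AllPairs using (AllPairs; []; _∷_)
import Data.List.Relation.Unary.AllPairs.Properties as AllPairsₚ
open import Data.List.Relation.Unary.Any using (Any; here; there)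
import Data.List.Relation.Unary.Any.Properties as Anyₚ
open import Data.List.Relation.Unary.Linked.Properties using (Linked⇒AllPairs)
import Data.List.Relation.Unary.Sorted.TotalOrder as SortedBy
import Data.List.Relation.Unary.Sorted.TotalOrder.Properties as Sortedₚ
open import Data.Nat using (ℕ; zero; suc; _+_; _*_; _∸_; _≤_; _<_; z≤n; s≤s; z<s; _≡ᵇ_)
open import Data.Nat.Properties
  using (≤-trans; ≤-refl; ≤-reflexive; ≤-pred; <⇒≤; <-irrefl; n≤1+n; m≤m+n; +-suc; +-comm; +-assoc; +-identityʳ; 1+n≢0;
         m+[n∸m]≡n; m+n∸m≡n; m∸n≤m; m∸n≡0⇒m≤n; m≤n⇒m∸n≡0; n∸n≡0; ∸-+-assoc; ∸-monoʳ-<; m<n⇒0<n∸m; m∸[m∸n]≡n;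
         m≤n⇒m<n∨m≡n)
open import Data.Nat.Tactic.RingSolver using (solve-∀)
open import Data.Product using (Σ; _×_; _,_; proj₁; proj₂)
open import Data.Sum using (_⊎_; inj₁; inj₂)
open import Data.Unit using (⊤; tt)
open import Function using (_∘_)
open import Level using (0ℓ)
open import Relation.Binary.Bundles using (TotalOrder)
open import Relation.Binary.PropositionalEquality

-- Lexicographic order and sorting

_≼_ : Word → Word → Set
u ≼ v = lexLeq u v ≡ true

lexLeq-refl : ∀ u → u ≼ u
lexLeq-refl [] = refl
lexLeq-refl (𝕒 ∷ u) = lexLeq-refl u
lexLeq-refl (𝕓 ∷ u) = lexLeq-refl u

lexLeq-swap : ∀ u v → lexLeq u v ≡ false → v ≼ u
lexLeq-swap [] v ()
lexLeq-swap (x ∷ u) [] h = refl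
lexLeq-swap (𝕒 ∷ u) (𝕒 ∷ v) h = lexLeq-swap u v h
lexLeq-swap (𝕒 ∷ u) (𝕓 ∷ v) ()
lexLeq-swap (𝕓 ∷ u) (𝕒 ∷ v) h = refl
lexLeq-swap (𝕓 ∷ u) (𝕓 ∷ v) h = lexLeq-swap u v h

lexLeq-total : ∀ u v → u ≼ v ⊎ v ≼ u
lexLeq-total u v with lexLeq u v in eq
... | true = inj₁ refl
... | false = inj₂ (lexLeq-swap u v eq)

lexLeq-antisym : ∀ u v → u ≼ v → v ≼ u → u ≡ v
lexLeq-antisym [] [] h1 h2 = refl
lexLeq-antisym [] (y ∷ v) h1 ()
lexLeq-antisym (x ∷ u) [] () h2
lexLeq-antisym (𝕒 ∷ u) (𝕒 ∷ v) h1 h2 = cong (𝕒 ∷_) (lexLeq-antisym u v h1 h2)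
lexLeq-antisym (𝕒 ∷ u) (𝕓 ∷ v) h1 ()
lexLeq-antisym (𝕓 ∷ u) (𝕒 ∷ v) () h2
lexLeq-antisym (𝕓 ∷ u) (𝕓 ∷ v) h1 h2 = cong (𝕓 ∷_) (lexLeq-antisym u v h1 h2)

lexLeq-trans : ∀ u v w → u ≼ v → v ≼ w → u ≼ w
lexLeq-trans [] v w h1 h2 = refl
lexLeq-trans (x ∷ u) [] w () h2
lexLeq-trans (x ∷ u) (y ∷ v) [] h1 ()
lexLeq-trans (𝕒 ∷ u) (𝕒 ∷ v) (𝕒 ∷ w) h1 h2 = lexLeq-trans u v w h1 h2
lexLeq-trans (𝕒 ∷ u) (𝕒 ∷ v) (𝕓 ∷ w) h1 h2 = refl
lexLeq-trans (𝕒 ∷ u) (𝕓 ∷ v) (𝕒 ∷ w) h1 ()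
lexLeq-trans (𝕒 ∷ u) (𝕓 ∷ v) (𝕓 ∷ w) h1 h2 = refl
lexLeq-trans (𝕓 ∷ u) (𝕒 ∷ v) w () h2
lexLeq-trans (𝕓 ∷ u) (𝕓 ∷ v) (𝕒 ∷ w) h1 ()
lexLeq-trans (𝕓 ∷ u) (𝕓 ∷ v) (𝕓 ∷ w) h1 h2 = lexLeq-trans u v w h1 h2

lexOrder : TotalOrder 0ℓ 0ℓ 0ℓ
lexOrder = record
  { Carrier = Word
  ; _≈_ = _≡_
  ; _≤_ = _≼_
  ; isTotalOrder = record
    { isPartialOrder = record
      { isPreorder = record
        { isEquivalence = isEquivalence
        ; reflexive = λ { {u} refl → lexLeq-refl u }
        ; trans = λ {u} {v} {w} → lexLeq-trans u v w
        }
      ; antisym = λ {u} {v} → lexLeq-antisym u v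
      }
    ; total = lexLeq-total
    }
  }

open SortedBy lexOrder using (Sorted)
open import Data.List.Relation.Unary.Linked as Linked using ([]; [-]; _∷_)

insert-↭ : ∀ u vs → insert u vs ↭ u ∷ vs
insert-↭ u [] = ↭-refl
insert-↭ u (v ∷ vs) with lexLeq u v
... | true = ↭-refl
... | false = ↭-trans (prep v (insert-↭ u vs)) (swap v u ↭-refl)

insert-sorted-after : ∀ u v vs → Sorted (v ∷ vs) → v ≼ u → Sorted (v ∷ insert u vs)
insert-sorted-after u v [] s v≼u = v≼u ∷ [-]
insert-sorted-after u v (w ∷ ws) (v≼w ∷ s) v≼u with lexLeq u w in u≼w
... | true = v≼u ∷ u≼w ∷ s
... | false = v≼w ∷ insert-sorted-after u w ws s (lexLeq-swap u w u≼w)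

insert-sorted : ∀ u vs → Sorted vs → Sorted (insert u vs)
insert-sorted u [] s = [-]
insert-sorted u (v ∷ vs) s with lexLeq u v in u≼v
... | true = u≼v ∷ s
... | false = insert-sorted-after u v vs s (lexLeq-swap u v u≼v)

sortWords-↭ : ∀ us → sortWords us ↭ us
sortWords-↭ [] = ↭-refl
sortWords-↭ (u ∷ us) = ↭-trans (insert-↭ u (sortWords us)) (prep u (sortWords-↭ us))

sortWords-sorted : ∀ us → Sorted (sortWords us)
sortWords-sorted [] = []
sortWords-sorted (u ∷ us) = insert-sorted u (sortWords us) (sortWords-sorted us)

sortWords-unique : ∀ us vs → Sorted vs → vs ↭ us → sortWords us ≡ vs
sortWords-unique us vs vs↗ vs↭us = Pointwise-≡⇒≡
  (Sortedₚ.↗↭↗⇒≋ lexOrder (sortWords-sorted us) vs↗ (↭⇒↭ₛ (↭-trans (sortWords-↭ us) (↭-sym vs↭us))))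

-- β filters with a function local to its where block, which cannot be named;
-- β-unfold captures it by unification against its defining equations.

FilterEquations : ((Word → Bool) → List Word → List Word) → Set
FilterEquations F = (∀ p → F p [] ≡ []) × (∀ p u us → F p (u ∷ us) ≡ (if p u then u ∷ F p us else F p us))

UnfoldsVia : Word → Word → ((Word → Bool) → List Word → List Word) → Set
UnfoldsVia x w F = (β x w ≡ map (lastOr 𝕒) (F (isPrefix x) (sortWords (conjugates w)))) × FilterEquations F

β-unfold : ∀ x w → UnfoldsVia x w _
β-unfold x w with isPrefix x | sortWords (conjugates w)
... | p | L = refl , (λ p → refl) , (λ p u us → refl)

FilterEquations⇒filterᵇ : ∀ F → FilterEquations F → ∀ p us → F p us ≡ filterᵇ p us
FilterEquations⇒filterᵇ F (nil , cons) p [] = nil p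
FilterEquations⇒filterᵇ F eqns@(nil , cons) p (u ∷ us) with p u in pu
... | true = trans (cons p u us) (trans (cong (λ b → if b then u ∷ F p us else F p us) pu) (cong (u ∷_) (FilterEquations⇒filterᵇ F eqns p us)))
... | false = trans (cons p u us) (trans (cong (λ b → if b then u ∷ F p us else F p us) pu) (FilterEquations⇒filterᵇ F eqns p us))

β-filterᵇ : ∀ x w → β x w ≡ map (lastOr 𝕒) (filterᵇ (isPrefix x) (sortWords (conjugates w)))
β-filterᵇ x w = via (β-unfold x w)
  where
  via : ∀ {F} → UnfoldsVia x w F → β x w ≡ map (lastOr 𝕒) (filterᵇ (isPrefix x) (sortWords (conjugates w)))
  via {F} (β≡ , eqns) = trans β≡ (cong (map (lastOr 𝕒)) (FilterEquations⇒filterᵇ F eqns (isPrefix x) _))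

filterᵇ-++ : ∀ {A : Set} (p : A → Bool) xs ys → filterᵇ p (xs ++ ys) ≡ filterᵇ p xs ++ filterᵇ p ys
filterᵇ-++ p = filter-++ (T? ∘ p)

filterᵇ-all : ∀ {A : Set} (p : A → Bool) {xs} → All (λ x → p x ≡ true) xs → filterᵇ p xs ≡ xs
filterᵇ-all p = filter-all (T? ∘ p) ∘ All.map (λ px → subst T (sym px) tt)

filterᵇ-none : ∀ {A : Set} (p : A → Bool) {xs} → All (λ x → p x ≡ false) xs → filterᵇ p xs ≡ []
filterᵇ-none p = filter-none (T? ∘ p) ∘ All.map (subst T)

filterᵇ-accept : ∀ {A : Set} (p : A → Bool) {x xs} → p x ≡ true → filterᵇ p (x ∷ xs) ≡ x ∷ filterᵇ p xs
filterᵇ-accept p px = filter-accept (T? ∘ p) (subst T (sym px) tt)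

filterᵇ-reject : ∀ {A : Set} (p : A → Bool) {x xs} → p x ≡ false → filterᵇ p (x ∷ xs) ≡ filterᵇ p xs
filterᵇ-reject p px = filter-reject (T? ∘ p) (subst T px)

filterᵇ-All : ∀ {A : Set} {P : A → Set} (p : A → Bool) xs → All (λ x → p x ≡ true → P x) xs → All P (filterᵇ p xs)
filterᵇ-All p [] [] = []
filterᵇ-All p (x ∷ xs) (px ∷ pxs) with p x
... | true = px refl ∷ filterᵇ-All p xs pxs
... | false = filterᵇ-All p xs pxs

filterᵇ-filterᵇ : ∀ {A : Set} (p q : A → Bool) → (∀ x → q x ≡ true → p x ≡ true) → ∀ xs → filterᵇ q (filterᵇ p xs) ≡ filterᵇ q xs
filterᵇ-filterᵇ p q q⇒p [] = refl
filterᵇ-filterᵇ p q q⇒p (x ∷ xs) with p x in px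
... | true with q x
...   | true = cong (x ∷_) (filterᵇ-filterᵇ p q q⇒p xs)
...   | false = filterᵇ-filterᵇ p q q⇒p xs
filterᵇ-filterᵇ p q q⇒p (x ∷ xs) | false with q x in qx
...   | false = filterᵇ-filterᵇ p q q⇒p xs
...   | true with () ← trans (sym px) (q⇒p x qx)

filterᵇ-map : ∀ {A B : Set} (f : A → B) (p : B → Bool) xs → filterᵇ p (map f xs) ≡ map f (filterᵇ (p ∘ f) xs)
filterᵇ-map f p [] = refl
filterᵇ-map f p (x ∷ xs) with p (f x)
... | true = cong (f x ∷_) (filterᵇ-map f p xs)
... | false = filterᵇ-map f p xs

filterᵇ-cong-All : ∀ {A : Set} {P : A → Set} (p q : A → Bool) → (∀ {x} → P x → p x ≡ q x) → ∀ {xs} → All P xs → filterᵇ p xs ≡ filterᵇ q xs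
filterᵇ-cong-All p q p≗q [] = refl
filterᵇ-cong-All p q p≗q {x ∷ xs} (px ∷ pxs) rewrite p≗q px with q x
... | true = cong (x ∷_) (filterᵇ-cong-All p q p≗q pxs)
... | false = filterᵇ-cong-All p q p≗q pxs

filterᵇ-sortWords : ∀ p us → filterᵇ p (sortWords us) ≡ sortWords (filterᵇ p us)
filterᵇ-sortWords p us = sym (sortWords-unique (filterᵇ p us) (filterᵇ p (sortWords us))
  (Sortedₚ.filter⁺ lexOrder (T? ∘ p) (sortWords-sorted us)) (filter-↭ (T? ∘ p) (sortWords-↭ us)))

β-sortWords : ∀ x w → β x w ≡ map (lastOr 𝕒) (sortWords (filterᵇ (isPrefix x) (conjugates w)))
β-sortWords x w = trans (β-filterᵇ x w) (cong (map (lastOr 𝕒)) (filterᵇ-sortWords (isPrefix x) (conjugates w)))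

-- Separated prefix classes

Below : (Word → Bool) → (Word → Bool) → Set
Below p q = ∀ u v → p u ≡ true → q v ≡ true → lexLeq v u ≡ false

-- A record rather than a synonym of Below, so that x and y can be inferred from x ⊏ y.
record _⊏_ (x y : Word) : Set where
  constructor below
  field ⊏-below : Below (isPrefix x) (isPrefix y)
open _⊏_

⊏-disjoint : ∀ {x y} → x ⊏ y → ∀ u → isPrefix y u ≡ true → isPrefix x u ≡ false
⊏-disjoint {x} {y} x⊏y u yu with isPrefix x u in xu
... | false = refl
... | true with () ← trans (sym (lexLeq-refl u)) (⊏-below x⊏y u u xu yu)

𝕒⊏𝕓 : ∀ x y → (𝕒 ∷ x) ⊏ (𝕓 ∷ y)
𝕒⊏𝕓 x y = below λ { (𝕒 ∷ u) (𝕓 ∷ v) _ _ → refl ; (𝕒 ∷ u) (𝕒 ∷ v) _ () ; (𝕓 ∷ u) v () _ }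

⊏-cons : ∀ c {x y} → x ⊏ y → (c ∷ x) ⊏ (c ∷ y)
⊏-cons 𝕒 x⊏y = below λ { (𝕒 ∷ u) (𝕒 ∷ v) xu yv → ⊏-below x⊏y u v xu yv ; (𝕒 ∷ u) (𝕓 ∷ v) _ () ; (𝕓 ∷ u) v () _ }
⊏-cons 𝕓 x⊏y = below λ { (𝕓 ∷ u) (𝕓 ∷ v) xu yv → ⊏-below x⊏y u v xu yv ; (𝕓 ∷ u) (𝕒 ∷ v) _ () ; (𝕒 ∷ u) v () _ }

sorted-head-min : ∀ {u us} → Sorted (u ∷ us) → All (u ≼_) us
sorted-head-min us↗ with Linked⇒AllPairs (λ {u} {v} {w} → lexLeq-trans u v w) us↗
... | u≼us ∷ _ = u≼us

sorted-split : ∀ (p : Word → Bool) us → Sorted us →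
  All (λ v → p v ≡ false → ∀ u → p u ≡ true → lexLeq v u ≡ false) us →
  us ≡ filterᵇ p us ++ filterᵇ (not ∘ p) us
sorted-split p [] _ _ = refl
sorted-split p (u ∷ us) us↗ (above ∷ aboves) = by-cases (p u) refl
  where
  open ≡-Reasoning
  u≼us : All (u ≼_) us
  u≼us = sorted-head-min us↗
  by-cases : ∀ b → p u ≡ b → u ∷ us ≡ filterᵇ p (u ∷ us) ++ filterᵇ (not ∘ p) (u ∷ us)
  by-cases true pu =
    begin
      u ∷ us
    ≡⟨ cong (u ∷_) (sorted-split p us (Linked.tail us↗) aboves) ⟩
      u ∷ filterᵇ p us ++ filterᵇ (not ∘ p) us
    ≡⟨ cong₂ _++_ (sym (filterᵇ-accept p pu)) (sym (filterᵇ-reject (not ∘ p) (cong not pu))) ⟩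
      filterᵇ p (u ∷ us) ++ filterᵇ (not ∘ p) (u ∷ us)
    ∎
  by-cases false pu =
    begin
      u ∷ us
    ≡⟨ cong (u ∷_) (sym (filterᵇ-all (not ∘ p) (All.map (cong not ∘ nowhere) u≼us))) ⟩
      u ∷ filterᵇ (not ∘ p) us
    ≡⟨ cong₂ _++_ (sym (trans (filterᵇ-reject p pu) (filterᵇ-none p (All.map nowhere u≼us))))
                  (sym (filterᵇ-accept (not ∘ p) (cong not pu))) ⟩
      filterᵇ p (u ∷ us) ++ filterᵇ (not ∘ p) (u ∷ us)
    ∎
    where
    nowhere : ∀ {v} → u ≼ v → p v ≡ false
    nowhere {v} u≼v with p v in pv
    ... | false = refl
    ... | true with () ← trans (sym u≼v) (above pu v pv)

HasPrefixIn : List Word → Word → Set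
HasPrefixIn xs u = Any (λ x → isPrefix x u ≡ true) xs

sorted-classes : ∀ xs us → AllPairs _⊏_ xs → Sorted us → All (HasPrefixIn xs) us →
  us ≡ concatMap (λ x → filterᵇ (isPrefix x) us) xs
sorted-classes [] [] _ _ _ = refl
sorted-classes [] (u ∷ us) _ _ (() ∷ _)
sorted-classes (x ∷ xs) us (x⊏xs ∷ xs-pairs) us↗ covered =
  begin
    us
  ≡⟨ sorted-split (isPrefix x) us us↗ (All.map (above x⊏xs) covered) ⟩
    filterᵇ (isPrefix x) us ++ rest
  ≡⟨ cong (filterᵇ (isPrefix x) us ++_) (sorted-classes xs rest xs-pairs rest↗ rest-covered) ⟩
    filterᵇ (isPrefix x) us ++ concatMap (λ y → filterᵇ (isPrefix y) rest) xs
  ≡⟨ cong (λ zs → filterᵇ (isPrefix x) us ++ concat zs) (map-cong-local (All.map unfiltered x⊏xs)) ⟩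
    filterᵇ (isPrefix x) us ++ concatMap (λ y → filterᵇ (isPrefix y) us) xs
  ∎
  where
  open ≡-Reasoning
  rest : List Word
  rest = filterᵇ (not ∘ isPrefix x) us
  rest↗ : Sorted rest
  rest↗ = Sortedₚ.filter⁺ lexOrder (T? ∘ (not ∘ isPrefix x)) us↗
  above : ∀ {ys v} → All (x ⊏_) ys → Any (λ y → isPrefix y v ≡ true) (x ∷ ys) →
    isPrefix x v ≡ false → ∀ u → isPrefix x u ≡ true → lexLeq v u ≡ false
  above _ (here xv) ¬xv with () ← trans (sym xv) ¬xv
  above (x⊏y ∷ _) (there (here yv)) _ u xu = ⊏-below x⊏y u _ xu yv
  above (_ ∷ x⊏ys) (there (there yv)) = above x⊏ys (there yv)
  rest-covered : All (HasPrefixIn xs) rest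
  rest-covered = filterᵇ-All (not ∘ isPrefix x) us (All.map elsewhere covered)
    where
    elsewhere : ∀ {v} → HasPrefixIn (x ∷ xs) v → not (isPrefix x v) ≡ true → HasPrefixIn xs v
    elsewhere (here xv) ¬xv with () ← trans (sym (cong not xv)) ¬xv
    elsewhere (there yv) _ = yv
  unfiltered : ∀ {y} → x ⊏ y → filterᵇ (isPrefix y) rest ≡ filterᵇ (isPrefix y) us
  unfiltered x⊏y = filterᵇ-filterᵇ (not ∘ isPrefix x) _ (λ v yv → cong not (⊏-disjoint x⊏y v yv)) us

BWT-classes : ∀ w xs → AllPairs _⊏_ xs → All (HasPrefixIn xs) (conjugates w) →
  BWT w ≡ concatMap (λ x → β x w) xs
BWT-classes w xs xs-pairs covered =
  begin
    map (lastOr 𝕒) (sortWords (conjugates w))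
  ≡⟨ cong (map (lastOr 𝕒)) (sorted-classes xs _ xs-pairs (sortWords-sorted (conjugates w)) (All-resp-↭ (↭-sym (sortWords-↭ (conjugates w))) covered)) ⟩
    map (lastOr 𝕒) (concatMap (λ x → filterᵇ (isPrefix x) (sortWords (conjugates w))) xs)
  ≡⟨ map-concatMap (lastOr 𝕒) _ xs ⟩
    concatMap (λ x → map (lastOr 𝕒) (filterᵇ (isPrefix x) (sortWords (conjugates w)))) xs
  ≡⟨ concatMap-cong (λ x → sym (β-filterᵇ x w)) xs ⟩
    concatMap (λ x → β x w) xs
  ∎
  where open ≡-Reasoning

-- Run-length encoded words and their rotations

Run : Set
Run = Letter × ℕ

-- The key of a rotation: its first five runs (the first one cut at the starting
-- point) and its last letter.
Key : Set
Key = List Run × Letter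

KeyedWord : Set
KeyedWord = Word × Key

expand : List Run → Word
expand [] = []
expand ((c , m) ∷ rs) = c ^ᴸ m ++ expand rs

expand-++ : ∀ xs ys → expand (xs ++ ys) ≡ expand xs ++ expand ys
expand-++ [] ys = refl
expand-++ ((c , m) ∷ xs) ys = trans (cong (c ^ᴸ m ++_) (expand-++ xs ys)) (sym (++-assoc (c ^ᴸ m) (expand xs) (expand ys)))

length-^ᴸ : ∀ c m → length (c ^ᴸ m) ≡ m
length-^ᴸ c zero = refl
length-^ᴸ c (suc m) = cong suc (length-^ᴸ c m)

drop-^ᴸ : ∀ c m i Z → i ≤ m → drop i (c ^ᴸ m ++ Z) ≡ c ^ᴸ (m ∸ i) ++ Z
drop-^ᴸ c m zero Z h = refl
drop-^ᴸ c (suc m) (suc i) Z (s≤s h) = drop-^ᴸ c m i Z h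

take-^ᴸ : ∀ c m i Z → i ≤ m → take i (c ^ᴸ m ++ Z) ≡ c ^ᴸ i
take-^ᴸ c m zero Z h = refl
take-^ᴸ c (suc m) (suc i) Z (s≤s h) = cong (c ∷_) (take-^ᴸ c m i Z h)

drop-^ᴸ-+ : ∀ c m i Z → drop (m + i) (c ^ᴸ m ++ Z) ≡ drop i Z
drop-^ᴸ-+ c zero i Z = refl
drop-^ᴸ-+ c (suc m) i Z = drop-^ᴸ-+ c m i Z

take-^ᴸ-+ : ∀ c m i Z → take (m + i) (c ^ᴸ m ++ Z) ≡ c ^ᴸ m ++ take i Z
take-^ᴸ-+ c zero i Z = refl
take-^ᴸ-+ c (suc m) i Z = cong (c ∷_) (take-^ᴸ-+ c m i Z)

drop-++-≤ : ∀ {A : Set} i (E P : List A) → i ≤ length E → drop i (E ++ P) ≡ drop i E ++ P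
drop-++-≤ zero E P h = refl
drop-++-≤ (suc i) (x ∷ E) P (s≤s h) = drop-++-≤ i E P h

take-++-≤ : ∀ {A : Set} i (E P : List A) → i ≤ length E → take i (E ++ P) ≡ take i E
take-++-≤ zero E P h = refl
take-++-≤ (suc i) (x ∷ E) P (s≤s h) = cong (x ∷_) (take-++-≤ i E P h)

applyUpTo-+ : ∀ {A : Set} (f : ℕ → A) m n → applyUpTo f (m + n) ≡ applyUpTo f m ++ applyUpTo (λ i → f (m + i)) n
applyUpTo-+ f zero n = refl
applyUpTo-+ f (suc m) n = cong (f 0 ∷_) (applyUpTo-+ (λ i → f (suc i)) m n)

applyUpTo-cong : ∀ {A : Set} (f g : ℕ → A) n → (∀ i → i < n → f i ≡ g i) → applyUpTo f n ≡ applyUpTo g n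
applyUpTo-cong f g zero h = refl
applyUpTo-cong f g (suc n) h = cong₂ _∷_ (h 0 (s≤s z≤n)) (applyUpTo-cong (λ i → f (suc i)) (λ i → g (suc i)) n (λ i lt → h (suc i) (s≤s lt)))

runRotations : Letter → ℕ → List Run → Letter → List KeyedWord
runRotations c m F prev = applyUpTo (λ j → (c ^ᴸ (m ∸ j) ++ expand F ++ c ^ᴸ j , ((c , m ∸ j) ∷ take 4 F) , (if j ≡ᵇ 0 then prev else c))) m

keyedRotations : List Run → List Run → Letter → List KeyedWord
keyedRotations [] pre prev = []
keyedRotations ((c , m) ∷ ms) pre prev = runRotations c m (ms ++ pre) prev ++ keyedRotations ms (pre ++ (c , m) ∷ []) c

rotate-inRun : ∀ c m E P i → i < m → rotate i ((c ^ᴸ m ++ E) ++ P) ≡ c ^ᴸ (m ∸ i) ++ (E ++ P) ++ c ^ᴸ i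
rotate-inRun c m E P i h =
  begin
    drop i ((c ^ᴸ m ++ E) ++ P) ++ take i ((c ^ᴸ m ++ E) ++ P)
  ≡⟨ cong (λ t → drop i t ++ take i t) (++-assoc (c ^ᴸ m) E P) ⟩
    drop i (c ^ᴸ m ++ (E ++ P)) ++ take i (c ^ᴸ m ++ (E ++ P))
  ≡⟨ cong₂ _++_ (drop-^ᴸ c m i (E ++ P) (≤-trans (n≤1+n i) h)) (take-^ᴸ c m i (E ++ P) (≤-trans (n≤1+n i) h)) ⟩
    (c ^ᴸ (m ∸ i) ++ (E ++ P)) ++ c ^ᴸ i
  ≡⟨ ++-assoc (c ^ᴸ (m ∸ i)) (E ++ P) (c ^ᴸ i) ⟩
    c ^ᴸ (m ∸ i) ++ (E ++ P) ++ c ^ᴸ i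
  ∎
  where open ≡-Reasoning

rotate-pastRun : ∀ c m E P i → i < length E → rotate (m + i) ((c ^ᴸ m ++ E) ++ P) ≡ rotate i (E ++ (P ++ c ^ᴸ m ++ []))
rotate-pastRun c m E P i h =
  begin
    drop (m + i) ((c ^ᴸ m ++ E) ++ P) ++ take (m + i) ((c ^ᴸ m ++ E) ++ P)
  ≡⟨ cong (λ t → drop (m + i) t ++ take (m + i) t) (++-assoc (c ^ᴸ m) E P) ⟩
    drop (m + i) (c ^ᴸ m ++ (E ++ P)) ++ take (m + i) (c ^ᴸ m ++ (E ++ P))
  ≡⟨ cong₂ _++_ (drop-^ᴸ-+ c m i (E ++ P)) (take-^ᴸ-+ c m i (E ++ P)) ⟩
    drop i (E ++ P) ++ (c ^ᴸ m ++ take i (E ++ P))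
  ≡⟨ cong₂ (λ a b → a ++ (c ^ᴸ m ++ b)) (drop-++-≤ i E P i≤) (take-++-≤ i E P i≤) ⟩
    (drop i E ++ P) ++ (c ^ᴸ m ++ take i E)
  ≡⟨ ++-assoc (drop i E) P _ ⟩
    drop i E ++ (P ++ (c ^ᴸ m ++ take i E))
  ≡⟨ cong (λ t → drop i E ++ t) (sym (++-assoc P (c ^ᴸ m) (take i E))) ⟩
    drop i E ++ ((P ++ c ^ᴸ m) ++ take i E)
  ≡⟨ cong (λ t → drop i E ++ (t ++ take i E)) (cong (P ++_) (sym (++-identityʳ (c ^ᴸ m)))) ⟩
    drop i E ++ ((P ++ c ^ᴸ m ++ []) ++ take i E)
  ≡⟨ sym (++-assoc (drop i E) (P ++ c ^ᴸ m ++ []) (take i E)) ⟩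
    (drop i E ++ (P ++ c ^ᴸ m ++ [])) ++ take i E
  ≡⟨ sym (cong₂ _++_ (drop-++-≤ i E _ i≤) (take-++-≤ i E _ i≤)) ⟩
    drop i (E ++ (P ++ c ^ᴸ m ++ [])) ++ take i (E ++ (P ++ c ^ᴸ m ++ []))
  ∎
  where
  open ≡-Reasoning
  i≤ : i ≤ length E
  i≤ = ≤-trans (n≤1+n i) h

rotations-keyed : ∀ ms pre prev → applyUpTo (λ i → rotate i (expand ms ++ expand pre)) (length (expand ms)) ≡ map proj₁ (keyedRotations ms pre prev)
rotations-keyed [] pre prev = refl
rotations-keyed ((c , m) ∷ ms) pre prev =
  begin
    applyUpTo (λ i → rotate i ((c ^ᴸ m ++ expand ms) ++ expand pre)) (length (c ^ᴸ m ++ expand ms))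
  ≡⟨ cong (applyUpTo (λ i → rotate i ((c ^ᴸ m ++ expand ms) ++ expand pre))) (trans (length-++ (c ^ᴸ m)) (cong (_+ length (expand ms)) (length-^ᴸ c m))) ⟩
    applyUpTo (λ i → rotate i ((c ^ᴸ m ++ expand ms) ++ expand pre)) (m + length (expand ms))
  ≡⟨ applyUpTo-+ _ m (length (expand ms)) ⟩
    applyUpTo (λ i → rotate i ((c ^ᴸ m ++ expand ms) ++ expand pre)) m ++ applyUpTo (λ i → rotate (m + i) ((c ^ᴸ m ++ expand ms) ++ expand pre)) (length (expand ms))
  ≡⟨ cong₂ _++_ part1 part2 ⟩
    map proj₁ (runRotations c m (ms ++ pre) prev) ++ map proj₁ (keyedRotations ms (pre ++ (c , m) ∷ []) c)
  ≡⟨ sym (map-++ proj₁ (runRotations c m (ms ++ pre) prev) _) ⟩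
    map proj₁ (runRotations c m (ms ++ pre) prev ++ keyedRotations ms (pre ++ (c , m) ∷ []) c)
  ∎
  where
  open ≡-Reasoning
  part1 : applyUpTo (λ i → rotate i ((c ^ᴸ m ++ expand ms) ++ expand pre)) m ≡ map proj₁ (runRotations c m (ms ++ pre) prev)
  part1 = trans (applyUpTo-cong _ _ m (λ i h → trans (rotate-inRun c m (expand ms) (expand pre) i h) (cong (λ t → c ^ᴸ (m ∸ i) ++ t ++ c ^ᴸ i) (sym (expand-++ ms pre)))))
                (sym (map-applyUpTo _ proj₁ m))
  part2 : applyUpTo (λ i → rotate (m + i) ((c ^ᴸ m ++ expand ms) ++ expand pre)) (length (expand ms)) ≡ map proj₁ (keyedRotations ms (pre ++ (c , m) ∷ []) c)
  part2 = trans (applyUpTo-cong _ _ (length (expand ms)) (λ i h → trans (rotate-pastRun c m (expand ms) (expand pre) i h) (cong (λ t → rotate i (expand ms ++ t)) (sym (expand-++ pre ((c , m) ∷ []))))))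
                (rotations-keyed ms (pre ++ (c , m) ∷ []) c)

conjugates-expand : ∀ R prev → conjugates (expand R) ≡ map proj₁ (keyedRotations R [] prev)
conjugates-expand R prev =
  begin
    map (λ i → rotate i (expand R)) (upTo (length (expand R)))
  ≡⟨ map-applyUpTo (λ i → i) (λ i → rotate i (expand R)) (length (expand R)) ⟩
    applyUpTo (λ i → rotate i (expand R)) (length (expand R))
  ≡⟨ cong (λ t → applyUpTo (λ i → rotate i t) (length (expand R))) (sym (++-identityʳ (expand R))) ⟩
    applyUpTo (λ i → rotate i (expand R ++ [])) (length (expand R))
  ≡⟨ rotations-keyed R [] prev ⟩
    map proj₁ (keyedRotations R [] prev)
  ∎
  where open ≡-Reasoning

lastOr-++ : ∀ d u v → lastOr d (u ++ v) ≡ lastOr (lastOr d u) v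
lastOr-++ d [] v = refl
lastOr-++ d (x ∷ u) v = lastOr-++ x u v

lastOr-^ᴸ-same : ∀ c m → lastOr c (c ^ᴸ m) ≡ c
lastOr-^ᴸ-same c zero = refl
lastOr-^ᴸ-same c (suc m) = lastOr-^ᴸ-same c m

lastOr-^ᴸ : ∀ d c m → 1 ≤ m → lastOr d (c ^ᴸ m) ≡ c
lastOr-^ᴸ d c (suc m) h = lastOr-^ᴸ-same c m

Describes : KeyedWord → Set
Describes (w , (K , l)) = (Σ Word λ X → w ≡ expand K ++ X) × (lastOr 𝕒 w ≡ l)

PositiveRuns : List Run → Set
PositiveRuns = All (λ r → 1 ≤ proj₂ r)

EndsIn : List Run → Letter → Set
EndsIn F prev = ∀ x → lastOr x (expand F) ≡ prev

PrecededBy : List Run → List Run → Letter → Set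
PrecededBy [] pre prev = ⊤
PrecededBy ((c , m) ∷ ms) pre prev = EndsIn (ms ++ pre) prev

runRotations-described : ∀ c m F prev → EndsIn F prev → All Describes (runRotations c m F prev)
runRotations-described c m F prev pk = applyUpTo⁺₁ _ m (el _)
  where
  el : ∀ j → j < m → Describes (c ^ᴸ (m ∸ j) ++ expand F ++ c ^ᴸ j , ((c , m ∸ j) ∷ take 4 F) , (if j ≡ᵇ 0 then prev else c))
  el j h = (expand (drop 4 F) ++ c ^ᴸ j , eqw) , lst j
    where
    eqw : c ^ᴸ (m ∸ j) ++ expand F ++ c ^ᴸ j ≡ (c ^ᴸ (m ∸ j) ++ expand (take 4 F)) ++ expand (drop 4 F) ++ c ^ᴸ j
    eqw = trans (cong (λ t → c ^ᴸ (m ∸ j) ++ t ++ c ^ᴸ j) (trans (cong expand (sym (take++drop≡id 4 F))) (expand-++ (take 4 F) (drop 4 F))))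
           (trans (cong (c ^ᴸ (m ∸ j) ++_) (++-assoc (expand (take 4 F)) (expand (drop 4 F)) (c ^ᴸ j)))
             (sym (++-assoc (c ^ᴸ (m ∸ j)) (expand (take 4 F)) _)))
    lst : ∀ j → lastOr 𝕒 (c ^ᴸ (m ∸ j) ++ expand F ++ c ^ᴸ j) ≡ (if j ≡ᵇ 0 then prev else c)
    lst zero = trans (lastOr-++ 𝕒 (c ^ᴸ m) (expand F ++ [])) (trans (lastOr-++ _ (expand F) []) (pk _))
    lst (suc j) = trans (lastOr-++ 𝕒 (c ^ᴸ (m ∸ suc j)) (expand F ++ c ^ᴸ suc j)) (trans (lastOr-++ _ (expand F) (c ^ᴸ suc j)) (lastOr-^ᴸ (lastOr (lastOr 𝕒 (c ^ᴸ (m ∸ suc j))) (expand F)) c (suc j) (s≤s z≤n)))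

keyedRotations-described : ∀ ms pre prev → PositiveRuns ms → PrecededBy ms pre prev → All Describes (keyedRotations ms pre prev)
keyedRotations-described [] pre prev pa pk = []
keyedRotations-described ((c , m) ∷ ms) pre prev (pm ∷ pa) pk = ++⁺ (runRotations-described c m (ms ++ pre) prev pk) (keyedRotations-described ms (pre ++ (c , m) ∷ []) c pa (nxt ms))
  where
  nxt : ∀ ms → PrecededBy ms (pre ++ (c , m) ∷ []) c
  nxt [] = tt
  nxt ((c' , m') ∷ ms') x =
    trans (cong (lastOr x) (expand-++ ms' (pre ++ (c , m) ∷ [])))
     (trans (lastOr-++ x (expand ms') _)
      (trans (cong (lastOr (lastOr x (expand ms'))) (expand-++ pre ((c , m) ∷ [])))
       (trans (lastOr-++ _ (expand pre) _)
        (trans (lastOr-++ _ (c ^ᴸ m) [])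
          (lastOr-^ᴸ _ c m pm)))))

key : Letter → ℕ → List Run → Letter → Key
key c e N l = ((c , e) ∷ N) , l

runKeys : Letter → ℕ → List Run → Letter → List Key
runKeys c m N p = applyUpTo (λ j → key c (m ∸ j) N (if j ≡ᵇ 0 then p else c)) m

innerKeys : Letter → List Run → ℕ → List Key
innerKeys c N m = applyUpTo (λ j → key c (m ∸ j) N c) m

keysOf : List Run → List Run → Letter → List Key
keysOf [] pre prev = []
keysOf ((c , m) ∷ ms) pre prev = runKeys c m (take 4 (ms ++ pre)) prev ++ keysOf ms (pre ++ (c , m) ∷ []) c

keyedRotations-keys : ∀ ms pre prev → map proj₂ (keyedRotations ms pre prev) ≡ keysOf ms pre prev
keyedRotations-keys [] pre prev = refl
keyedRotations-keys ((c , m) ∷ ms) pre prev =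
  trans (map-++ proj₂ (runRotations c m (ms ++ pre) prev) _)
   (cong₂ _++_ (map-applyUpTo _ proj₂ m) (keyedRotations-keys ms (pre ++ (c , m) ∷ []) c))

-- Decisive comparison of keys

opp : Letter → Letter
opp 𝕒 = 𝕓
opp 𝕓 = 𝕒

data RunsBelow : List Run → List Run → Set where
  letter : ∀ {p q F G} → 1 ≤ p → 1 ≤ q → RunsBelow ((𝕒 , p) ∷ F) ((𝕓 , q) ∷ G)
  shorter : ∀ {c d p q p' F G} → p < q → d <ᴸ c ≡ true → 1 ≤ p' → RunsBelow ((c , p) ∷ (d , p') ∷ F) ((c , q) ∷ G)
  longer : ∀ {c d p q q' F G} → q < p → c <ᴸ d ≡ true → 1 ≤ q' → RunsBelow ((c , p) ∷ F) ((c , q) ∷ (d , q') ∷ G)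
  same : ∀ {c p F G} → RunsBelow F G → RunsBelow ((c , p) ∷ F) ((c , p) ∷ G)

lexLeq-∷ : ∀ c U V → lexLeq (c ∷ U) (c ∷ V) ≡ lexLeq U V
lexLeq-∷ 𝕒 U V = refl
lexLeq-∷ 𝕓 U V = refl

lexLeq-^ᴸ : ∀ c p U V → lexLeq (c ^ᴸ p ++ U) (c ^ᴸ p ++ V) ≡ lexLeq U V
lexLeq-^ᴸ c zero U V = refl
lexLeq-^ᴸ c (suc p) U V = trans (lexLeq-∷ c (c ^ᴸ p ++ U) (c ^ᴸ p ++ V)) (lexLeq-^ᴸ c p U V)

lexLeq-<ᴸ : ∀ d c U V → d <ᴸ c ≡ true → lexLeq (d ∷ U) (c ∷ V) ≡ true
lexLeq-<ᴸ 𝕒 𝕓 U V h = refl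
lexLeq-<ᴸ 𝕒 𝕒 U V ()
lexLeq-<ᴸ 𝕓 𝕒 U V ()
lexLeq-<ᴸ 𝕓 𝕓 U V ()

lexLeq-shorter : ∀ c d p q p' U V → p < q → d <ᴸ c ≡ true → 1 ≤ p' → lexLeq (c ^ᴸ p ++ d ^ᴸ p' ++ U) (c ^ᴸ q ++ V) ≡ true
lexLeq-shorter c d zero (suc q) (suc p') U V h1 h2 h3 = lexLeq-<ᴸ d c (d ^ᴸ p' ++ U) (c ^ᴸ q ++ V) h2
lexLeq-shorter c d (suc p) (suc q) p' U V (s≤s h1) h2 h3 = trans (lexLeq-∷ c (c ^ᴸ p ++ d ^ᴸ p' ++ U) (c ^ᴸ q ++ V)) (lexLeq-shorter c d p q p' U V h1 h2 h3)

lexLeq-longer : ∀ c d p q q' U V → q < p → c <ᴸ d ≡ true → 1 ≤ q' → lexLeq (c ^ᴸ p ++ U) (c ^ᴸ q ++ d ^ᴸ q' ++ V) ≡ true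
lexLeq-longer c d (suc p) zero (suc q') U V h1 h2 h3 = lexLeq-<ᴸ c d (c ^ᴸ p ++ U) (d ^ᴸ q' ++ V) h2
lexLeq-longer c d (suc p) (suc q) q' U V (s≤s h1) h2 h3 = trans (lexLeq-∷ c (c ^ᴸ p ++ U) (c ^ᴸ q ++ d ^ᴸ q' ++ V)) (lexLeq-longer c d p q q' U V h1 h2 h3)

RunsBelow⇒≼ : ∀ {K1 K2} → RunsBelow K1 K2 → ∀ X Y → lexLeq (expand K1 ++ X) (expand K2 ++ Y) ≡ true
RunsBelow⇒≼ (letter {suc p} {suc q} h1 h2) X Y = refl
RunsBelow⇒≼ (shorter {c} {d} {p} {q} {p'} {F} {G} h1 h2 h3) X Y =
  trans (cong₂ lexLeq (trans (++-assoc (c ^ᴸ p) _ X) (cong (c ^ᴸ p ++_) (++-assoc (d ^ᴸ p') (expand F) X))) (++-assoc (c ^ᴸ q) (expand G) Y))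
        (lexLeq-shorter c d p q p' _ _ h1 h2 h3)
RunsBelow⇒≼ (longer {c} {d} {p} {q} {q'} {F} {G} h1 h2 h3) X Y =
  trans (cong₂ lexLeq (++-assoc (c ^ᴸ p) (expand F) X) (trans (++-assoc (c ^ᴸ q) _ Y) (cong (c ^ᴸ q ++_) (++-assoc (d ^ᴸ q') (expand G) Y))))
        (lexLeq-longer c d p q q' _ _ h1 h2 h3)
RunsBelow⇒≼ (same {c} {p} {F} {G} d) X Y =
  trans (cong₂ lexLeq (++-assoc (c ^ᴸ p) (expand F) X) (++-assoc (c ^ᴸ p) (expand G) Y))
   (trans (lexLeq-^ᴸ c p _ _) (RunsBelow⇒≼ d X Y))

data Chain : List Key → Set where
  chain[] : Chain []
  chain[-] : ∀ x → Chain (x ∷ [])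
  chain∷ : ∀ {x y ys} → RunsBelow (proj₁ x) (proj₁ y) → Chain (y ∷ ys) → Chain (x ∷ y ∷ ys)

Chain⇒Sorted : ∀ {L : List KeyedWord} → All Describes L → Chain (map proj₂ L) → Sorted (map proj₁ L)
Chain⇒Sorted {[]} a l = []
Chain⇒Sorted {x ∷ []} a l = [-]
Chain⇒Sorted {(w1 , K1 , l1) ∷ (w2 , K2 , l2) ∷ L} (((X1 , e1) , _) ∷ ((X2 , e2) , i2) ∷ a) (chain∷ d l) =
  (trans (cong₂ lexLeq e1 e2) (RunsBelow⇒≼ d X1 X2)) ∷ (Chain⇒Sorted (((X2 , e2) , i2) ∷ a) l)

ChainFrom : Key → List Key → Set
ChainFrom x ys = Chain (x ∷ ys)

lastKey : Key → List Key → Key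
lastKey x [] = x
lastKey x (y ∷ ys) = lastKey y ys

ChainFrom-++ : ∀ x ys zs → ChainFrom x ys → ChainFrom (lastKey x ys) zs → ChainFrom x (ys ++ zs)
ChainFrom-++ x [] zs c1 c2 = c2
ChainFrom-++ x (y ∷ []) zs (chain∷ d (chain[-] _)) c2 = chain∷ d c2
ChainFrom-++ x (y ∷ y' ∷ ys) zs (chain∷ d c1) c2 = chain∷ d (ChainFrom-++ y (y' ∷ ys) zs c1 c2)

ChainFrom-[-] : ∀ {x y} → RunsBelow (proj₁ x) (proj₁ y) → ChainFrom x (y ∷ [])
ChainFrom-[-] d = chain∷ d (chain[-] _)

ChainFrom⇒Chain : ∀ x ys → ChainFrom x ys → Chain ys
ChainFrom⇒Chain x [] c = chain[]
ChainFrom⇒Chain x (y ∷ ys) (chain∷ d c) = c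

lastKey-++ : ∀ x ys zs → lastKey x (ys ++ zs) ≡ lastKey (lastKey x ys) zs
lastKey-++ x [] zs = refl
lastKey-++ x (y ∷ ys) zs = lastKey-++ y ys zs

inClass : Letter → ℕ → Key → Bool
inClass c' e' ([] , l) = false
inClass c' e' ((c , e) ∷ K , l) = (c ==ᴸ c') ∧ (e ≡ᵇ e')

WellFormed : Key → Set
WellFormed ([] , l) = ⊥
WellFormed ((c , e) ∷ [] , l) = ⊥
WellFormed ((c , e) ∷ (d , p) ∷ K , l) = (1 ≤ e) × (d ≡ opp c) × (1 ≤ p)

isPrefix-run : ∀ c e e' Y → isPrefix (c ^ᴸ e' ++ opp c ∷ []) (c ^ᴸ e ++ opp c ∷ Y) ≡ (e ≡ᵇ e')
isPrefix-run 𝕒 zero zero Y = refl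
isPrefix-run 𝕒 zero (suc e') Y = refl
isPrefix-run 𝕒 (suc e) zero Y = refl
isPrefix-run 𝕒 (suc e) (suc e') Y = isPrefix-run 𝕒 e e' Y
isPrefix-run 𝕓 zero zero Y = refl
isPrefix-run 𝕓 zero (suc e') Y = refl
isPrefix-run 𝕓 (suc e) zero Y = refl
isPrefix-run 𝕓 (suc e) (suc e') Y = isPrefix-run 𝕓 e e' Y

isPrefix-runs : ∀ c c' e e' Y → 1 ≤ e → 1 ≤ e' → isPrefix (c' ^ᴸ e' ++ opp c' ∷ []) (c ^ᴸ e ++ opp c ∷ Y) ≡ (c ==ᴸ c') ∧ (e ≡ᵇ e')
isPrefix-runs 𝕒 𝕒 e e' Y h1 h2 = isPrefix-run 𝕒 e e' Y
isPrefix-runs 𝕓 𝕓 e e' Y h1 h2 = isPrefix-run 𝕓 e e' Y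
isPrefix-runs 𝕒 𝕓 (suc e) (suc e') Y h1 h2 = refl
isPrefix-runs 𝕓 𝕒 (suc e) (suc e') Y h1 h2 = refl

isPrefix-key : ∀ c' e' (y : KeyedWord) → 1 ≤ e' → Describes y → WellFormed (proj₂ y) → isPrefix (c' ^ᴸ e' ++ opp c' ∷ []) (proj₁ y) ≡ inClass c' e' (proj₂ y)
isPrefix-key c' e' (w , ((c , e) ∷ (.(opp c) , suc p) ∷ F) , l) h ((X , refl) , _) (he , refl , hp) =
  trans (cong (isPrefix (c' ^ᴸ e' ++ opp c' ∷ [])) (++-assoc (c ^ᴸ e) _ X)) (isPrefix-runs c c' e e' _ he h)

lastLetters-sorted : ∀ (M : List KeyedWord) S → All Describes M → map proj₂ M ↭ S → Chain S →
  map (lastOr 𝕒) (sortWords (map proj₁ M)) ≡ map proj₂ S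
lastLetters-sorted M S invs M↭S chain with ↭-map-inv proj₂ M↭S
... | M′ , refl , M↭M′ =
  begin
    map (lastOr 𝕒) (sortWords (map proj₁ M))
  ≡⟨ cong (map (lastOr 𝕒)) (sortWords-unique _ (map proj₁ M′) (Chain⇒Sorted invs′ chain) (map⁺ proj₁ (↭-sym M↭M′))) ⟩
    map (lastOr 𝕒) (map proj₁ M′)
  ≡⟨ sym (map-∘ M′) ⟩
    map (lastOr 𝕒 ∘ proj₁) M′
  ≡⟨ map-cong-local (All.map (λ { {w , K , l} (_ , last≡) → last≡ }) invs′) ⟩
    map (proj₂ ∘ proj₂) M′
  ≡⟨ map-∘ M′ ⟩
    map proj₂ (map proj₂ M′)
  ∎
  where
  open ≡-Reasoning
  invs′ : All Describes M′
  invs′ = All-resp-↭ M↭M′ invs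

β-keys : ∀ R prev c e S → PositiveRuns R → PrecededBy R [] prev → 1 ≤ e →
  All WellFormed (map proj₂ (keyedRotations R [] prev)) → filterᵇ (inClass c e) (map proj₂ (keyedRotations R [] prev)) ↭ S → Chain S →
  β (c ^ᴸ e ++ opp c ∷ []) (expand R) ≡ map proj₂ S
β-keys R prev c e S R⁺ R-prev 1≤e keys-wf class↭S chain =
  begin
    β x (expand R)
  ≡⟨ β-sortWords x (expand R) ⟩
    map (lastOr 𝕒) (sortWords (filterᵇ (isPrefix x) (conjugates (expand R))))
  ≡⟨ cong (λ C → map (lastOr 𝕒) (sortWords (filterᵇ (isPrefix x) C))) (conjugates-expand R prev) ⟩
    map (lastOr 𝕒) (sortWords (filterᵇ (isPrefix x) (map proj₁ KL)))
  ≡⟨ cong (map (lastOr 𝕒) ∘ sortWords) (filterᵇ-map proj₁ (isPrefix x) KL) ⟩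
    map (lastOr 𝕒) (sortWords (map proj₁ (filterᵇ (isPrefix x ∘ proj₁) KL)))
  ≡⟨ cong (map (lastOr 𝕒) ∘ sortWords ∘ map proj₁) (filterᵇ-cong-All _ _ (λ (inv , ok) → isPrefix-key c e _ 1≤e inv ok) both) ⟩
    map (lastOr 𝕒) (sortWords (map proj₁ (filterᵇ (inClass c e ∘ proj₂) KL)))
  ≡⟨ lastLetters-sorted _ S (filter⁺ (T? ∘ (inClass c e ∘ proj₂)) invs) class′↭S chain ⟩
    map proj₂ S
  ∎
  where
  open ≡-Reasoning
  x = c ^ᴸ e ++ opp c ∷ []
  KL = keyedRotations R [] prev
  invs : All Describes KL
  invs = keyedRotations-described R [] prev R⁺ R-prev
  both : All (λ y → Describes y × WellFormed (proj₂ y)) KL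
  both = All.zip (invs , map⁻ keys-wf)
  class′↭S : map proj₂ (filterᵇ (inClass c e ∘ proj₂) KL) ↭ S
  class′↭S = ↭-trans (↭-reflexive (sym (filterᵇ-map proj₂ (inClass c e) KL))) class↭S

-- The runs of ŵb

factor : ℕ → Word
factor i = (𝕒 ∷ (𝕓 ^ᴸ i)) ++ (𝕒 ∷ 𝕒 ∷ []) ++ (𝕒 ∷ (𝕓 ^ᴸ i)) ++ (𝕒 ∷ 𝕓 ∷ (𝕒 ^ᴸ (i ∸ 2)))

-- The factors a b^i a a · a b^i a b a^(i-2) of w_k regroup into the runs
-- a^(i-2) b^i a^3 b^i a b; blockRuns a n K lists the blocks i = a + 2, …, a + n + 1,
-- followed by the last a-run and the final run b^K.
blockRuns : ℕ → ℕ → ℕ → List Run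
blockRuns a zero K = (𝕒 , a) ∷ (𝕓 , K) ∷ []
blockRuns a (suc n) K = (𝕒 , a) ∷ (𝕓 , 2 + a) ∷ (𝕒 , 3) ∷ (𝕓 , 2 + a) ∷ (𝕒 , 1) ∷ (𝕓 , 1) ∷ blockRuns (suc a) n K

allRuns : ℕ → ℕ → List Run
allRuns n K = (𝕒 , 1) ∷ (𝕓 , 2) ∷ (𝕒 , 3) ∷ (𝕓 , 2) ∷ (𝕒 , 1) ∷ (𝕓 , 1) ∷ blockRuns 1 n K

ŵbRuns : ℕ → List Run
ŵbRuns t = allRuns (3 + t) (7 + t)

dropLast-snoc : ∀ u x → dropLast (u ++ x ∷ []) ≡ u
dropLast-snoc [] x = refl
dropLast-snoc (y ∷ []) x = refl
dropLast-snoc (y ∷ z ∷ u) x = cong (y ∷_) (dropLast-snoc (z ∷ u) x)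

^ᴸ-snoc : ∀ c n → c ^ᴸ n ++ c ∷ [] ≡ c ∷ c ^ᴸ n
^ᴸ-snoc c zero = refl
^ᴸ-snoc c (suc n) = cong (c ∷_) (^ᴸ-snoc c n)

^ᴸ-shift : ∀ c n Z → c ^ᴸ n ++ c ∷ Z ≡ c ∷ c ^ᴸ n ++ Z
^ᴸ-shift c zero Z = refl
^ᴸ-shift c (suc n) Z = cong (c ∷_) (^ᴸ-shift c n Z)

^ᴸ-++ : ∀ c m n → c ^ᴸ m ++ c ^ᴸ n ≡ c ^ᴸ (m + n)
^ᴸ-++ c zero n = refl
^ᴸ-++ c (suc m) n = cong (c ∷_) (^ᴸ-++ c m n)

factor-++ : ∀ i Q → factor i ++ Q ≡ 𝕒 ∷ 𝕓 ^ᴸ i ++ 𝕒 ∷ 𝕒 ∷ 𝕒 ∷ 𝕓 ^ᴸ i ++ 𝕒 ∷ 𝕓 ∷ 𝕒 ^ᴸ (i ∸ 2) ++ Q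
factor-++ i Q = cong (𝕒 ∷_) (trans (++-assoc (𝕓 ^ᴸ i) _ Q) (cong (λ t → 𝕓 ^ᴸ i ++ 𝕒 ∷ 𝕒 ∷ 𝕒 ∷ t) (++-assoc (𝕓 ^ᴸ i) _ Q)))

expand-blockRuns : ∀ c n K → 𝕒 ^ᴸ c ++ prod (3 + c) n factor ++ 𝕒 ∷ 𝕓 ^ᴸ K ≡ expand (blockRuns (suc c) n K)
expand-blockRuns c zero K = trans (^ᴸ-shift 𝕒 c (𝕓 ^ᴸ K)) (cong (λ t → 𝕒 ∷ 𝕒 ^ᴸ c ++ t) (sym (++-identityʳ (𝕓 ^ᴸ K))))
expand-blockRuns c (suc n) K =
  trans (cong (𝕒 ^ᴸ c ++_) (trans (++-assoc (factor (3 + c)) _ _) (factor-++ (3 + c) _)))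
   (trans (^ᴸ-shift 𝕒 c _)
     (cong (λ t → 𝕒 ∷ 𝕒 ^ᴸ c ++ 𝕓 ^ᴸ (3 + c) ++ 𝕒 ∷ 𝕒 ∷ 𝕒 ∷ 𝕓 ^ᴸ (3 + c) ++ 𝕒 ∷ 𝕓 ∷ t) (expand-blockRuns (suc c) n K)))

ŵb-expand : ∀ t → ŵb (6 + t) ≡ expand (allRuns (3 + t) (7 + t))
ŵb-expand t =
  trans (cong (_++ 𝕓 ∷ []) (trans (cong dropLast (sym (++-assoc P (𝕒 ∷ 𝕓 ^ᴸ (6 + t)) (𝕒 ∷ []))))
                                   (dropLast-snoc (P ++ 𝕒 ∷ 𝕓 ^ᴸ (6 + t)) 𝕒)))
   (trans (++-assoc P (𝕒 ∷ 𝕓 ^ᴸ (6 + t)) (𝕓 ∷ []))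
    (trans (cong (λ z → P ++ 𝕒 ∷ z) (^ᴸ-snoc 𝕓 (6 + t)))
     (trans (++-assoc (factor 2) (prod 3 (3 + t) factor) _)
      (cong (𝕒 ∷_) (cong (λ z → 𝕓 ∷ 𝕓 ∷ 𝕒 ∷ 𝕒 ∷ 𝕒 ∷ 𝕓 ∷ 𝕓 ∷ 𝕒 ∷ 𝕓 ∷ z) (expand-blockRuns 0 (3 + t) (7 + t)))))))
  where
  P : Word
  P = prod 2 (4 + t) factor

blockRuns-positive : ∀ a n K → 1 ≤ a → 1 ≤ K → PositiveRuns (blockRuns a n K)
blockRuns-positive a zero K ha hK = ha ∷ hK ∷ []
blockRuns-positive a (suc n) K ha hK = ha ∷ s≤s z≤n ∷ s≤s z≤n ∷ s≤s z≤n ∷ s≤s z≤n ∷ s≤s z≤n ∷ blockRuns-positive (suc a) n K (s≤s z≤n) hK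

allRuns-positive : ∀ n K → 1 ≤ K → PositiveRuns (allRuns n K)
allRuns-positive n K hK = s≤s z≤n ∷ s≤s z≤n ∷ s≤s z≤n ∷ s≤s z≤n ∷ s≤s z≤n ∷ s≤s z≤n ∷ blockRuns-positive 1 n K (s≤s z≤n) hK

lastOr-expand-++ : ∀ rs rs′ {c} → EndsIn rs′ c → EndsIn (rs ++ rs′) c
lastOr-expand-++ rs rs′ ends x =
  trans (cong (lastOr x) (expand-++ rs rs′)) (trans (lastOr-++ x (expand rs) (expand rs′)) (ends _))

blockRuns-endsIn𝕓 : ∀ a n K → 1 ≤ K → EndsIn (blockRuns a n K) 𝕓
blockRuns-endsIn𝕓 a zero K 1≤K =
  lastOr-expand-++ ((𝕒 , a) ∷ []) ((𝕓 , K) ∷ []) (λ x → trans (lastOr-++ x (𝕓 ^ᴸ K) []) (lastOr-^ᴸ x 𝕓 K 1≤K))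
blockRuns-endsIn𝕓 a (suc n) K 1≤K =
  lastOr-expand-++ ((𝕒 , a) ∷ (𝕓 , 2 + a) ∷ (𝕒 , 3) ∷ (𝕓 , 2 + a) ∷ (𝕒 , 1) ∷ (𝕓 , 1) ∷ []) (blockRuns (suc a) n K)
    (blockRuns-endsIn𝕓 (suc a) n K 1≤K)

allRuns-precededBy : ∀ n K → 1 ≤ K → PrecededBy (allRuns n K) [] 𝕓
allRuns-precededBy n K 1≤K =
  subst (λ rs → EndsIn rs 𝕓) (sym (++-identityʳ (rest ++ blockRuns 1 n K)))
    (lastOr-expand-++ rest (blockRuns 1 n K) (blockRuns-endsIn𝕓 1 n K 1≤K))
  where
  rest : List Run
  rest = (𝕓 , 2) ∷ (𝕒 , 3) ∷ (𝕓 , 2) ∷ (𝕒 , 1) ∷ (𝕓 , 1) ∷ []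

initialRuns : List Run
initialRuns = (𝕒 , 1) ∷ (𝕓 , 2) ∷ (𝕒 , 3) ∷ (𝕓 , 2) ∷ []

nextB : ℕ → ℕ → ℕ → ℕ
nextB a zero K = K
nextB a (suc n) K = 3 + a

nextA : ℕ → ℕ
nextA zero = 1
nextA (suc n) = 3

nextB′ : ℕ → ℕ → ℕ
nextB′ a zero = 2
nextB′ a (suc n) = 3 + a

next₁ next₂ next₃ : ℕ → List Run
next₁ a = (𝕓 , 2 + a) ∷ (𝕒 , 3) ∷ (𝕓 , 2 + a) ∷ (𝕒 , 1) ∷ []
next₂ a = (𝕒 , 3) ∷ (𝕓 , 2 + a) ∷ (𝕒 , 1) ∷ (𝕓 , 1) ∷ []
next₃ a = (𝕓 , 2 + a) ∷ (𝕒 , 1) ∷ (𝕓 , 1) ∷ (𝕒 , suc a) ∷ []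

next₄ : ℕ → ℕ → ℕ → List Run
next₄ a n K = (𝕒 , 1) ∷ (𝕓 , 1) ∷ (𝕒 , suc a) ∷ (𝕓 , nextB a n K) ∷ []

next₅ : ℕ → ℕ → ℕ → List Run
next₅ a n K = (𝕓 , 1) ∷ (𝕒 , suc a) ∷ (𝕓 , nextB a n K) ∷ (𝕒 , nextA n) ∷ []

next₆ : ℕ → ℕ → ℕ → List Run
next₆ a n K = (𝕒 , suc a) ∷ (𝕓 , nextB a n K) ∷ (𝕒 , nextA n) ∷ (𝕓 , nextB′ a n) ∷ []

nextFinal : ℕ → List Run
nextFinal K = (𝕓 , K) ∷ (𝕒 , 1) ∷ (𝕓 , 2) ∷ (𝕒 , 3) ∷ []

blockKeys : ℕ → ℕ → ℕ → List Key → List Key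
blockKeys a n K rest =
  runKeys 𝕒 a (next₁ a) 𝕓 ++ runKeys 𝕓 (2 + a) (next₂ a) 𝕒 ++ runKeys 𝕒 3 (next₃ a) 𝕓 ++
  runKeys 𝕓 (2 + a) (next₄ a n K) 𝕒 ++ runKeys 𝕒 1 (next₅ a n K) 𝕓 ++ runKeys 𝕓 1 (next₆ a n K) 𝕒 ++ rest

finalKeys : ℕ → ℕ → List Key
finalKeys a K = runKeys 𝕒 a (nextFinal K) 𝕓 ++ runKeys 𝕓 K initialRuns 𝕒

blocksKeys : ℕ → ℕ → ℕ → List Key
blocksKeys a zero K = finalKeys a K
blocksKeys a (suc n) K = blockKeys a n K (blocksKeys (suc a) n K)

afterBlock : ℕ → List Run → List Run
afterBlock a Q = (((((Q ++ (𝕒 , a) ∷ []) ++ (𝕓 , 2 + a) ∷ []) ++ (𝕒 , 3) ∷ []) ++ (𝕓 , 2 + a) ∷ []) ++ (𝕒 , 1) ∷ []) ++ (𝕓 , 1) ∷ []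

keysOf-blockRuns : ∀ a n K Q → keysOf (blockRuns a n K) (initialRuns ++ Q) 𝕓 ≡ blocksKeys a n K
keysOf-blockRuns a zero K Q = cong (runKeys 𝕒 a (nextFinal K) 𝕓 ++_) (++-identityʳ _)
keysOf-blockRuns a (suc zero) K Q = cong (blockKeys a 0 K) (keysOf-blockRuns (suc a) 0 K (afterBlock a Q))
keysOf-blockRuns a (suc (suc n)) K Q = cong (blockKeys a (suc n) K) (keysOf-blockRuns (suc a) (suc n) K (afterBlock a Q))

-- Block i = 2 starts with a single a instead of a^0: its one key is listed first and
-- the block is otherwise the regular one with a = 0.
ŵbKeys : ℕ → List Key
ŵbKeys t = key 𝕒 1 (next₁ 0) 𝕓 ∷ blocksKeys 0 (4 + t) (7 + t)

keysOf-ŵbRuns : ∀ t → keysOf (ŵbRuns t) [] 𝕓 ≡ ŵbKeys t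
keysOf-ŵbRuns t = cong (λ ks → key 𝕒 1 (next₁ 0) 𝕓 ∷ blockKeys 0 (3 + t) (7 + t) ks) (keysOf-blockRuns 1 (3 + t) (7 + t) ((𝕒 , 1) ∷ (𝕓 , 1) ∷ []))

≡ᵇ-refl : ∀ m → (m ≡ᵇ m) ≡ true
≡ᵇ-refl zero = refl
≡ᵇ-refl (suc m) = ≡ᵇ-refl m

<⇒≡ᵇ-false : ∀ m n → m < n → (m ≡ᵇ n) ≡ false
<⇒≡ᵇ-false zero (suc n) h = refl
<⇒≡ᵇ-false (suc m) (suc n) (s≤s h) = <⇒≡ᵇ-false m n h

>⇒≡ᵇ-false : ∀ m n → n < m → (m ≡ᵇ n) ≡ false
>⇒≡ᵇ-false (suc m) zero h = refl
>⇒≡ᵇ-false (suc m) (suc n) (s≤s h) = >⇒≡ᵇ-false m n h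

==ᴸ-refl : ∀ c → (c ==ᴸ c) ≡ true
==ᴸ-refl 𝕒 = refl
==ᴸ-refl 𝕓 = refl

innerKeys-above : ∀ c N m e → m < e → filterᵇ (inClass c e) (innerKeys c N m) ≡ []
innerKeys-above c N zero e h = refl
innerKeys-above c N (suc m) e h rewrite ==ᴸ-refl c | <⇒≡ᵇ-false (suc m) e h = innerKeys-above c N m e (≤-trans (n≤1+n _) h)

innerKeys-within : ∀ c N m e → 1 ≤ e → e ≤ m → filterᵇ (inClass c e) (innerKeys c N m) ≡ key c e N c ∷ []
innerKeys-within c N zero (suc e) h1 ()
innerKeys-within c N (suc m) e h1 h2 with m≤n⇒m<n∨m≡n h2
... | inj₂ refl rewrite ==ᴸ-refl c | ≡ᵇ-refl m = cong (key c (suc m) N c ∷_) (innerKeys-above c N m (suc m) ≤-refl)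
... | inj₁ (s≤s le) rewrite ==ᴸ-refl c | >⇒≡ᵇ-false (suc m) e (s≤s le) = innerKeys-within c N m e h1 le

runKeys-above : ∀ c m N p e → m < e → filterᵇ (inClass c e) (runKeys c m N p) ≡ []
runKeys-above c zero N p e h = refl
runKeys-above c (suc m) N p e h rewrite ==ᴸ-refl c | <⇒≡ᵇ-false (suc m) e h = innerKeys-above c N m e (≤-trans (n≤1+n _) h)

runKeys-top : ∀ c m N p → 1 ≤ m → filterᵇ (inClass c m) (runKeys c m N p) ≡ key c m N p ∷ []
runKeys-top c (suc m) N p h rewrite ==ᴸ-refl c | ≡ᵇ-refl m = cong (key c (suc m) N p ∷_) (innerKeys-above c N m (suc m) ≤-refl)

runKeys-within : ∀ c m N p e → 1 ≤ e → e < m → filterᵇ (inClass c e) (runKeys c m N p) ≡ key c e N c ∷ []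
runKeys-within c (suc m) N p e h1 h2 rewrite ==ᴸ-refl c | >⇒≡ᵇ-false (suc m) e h2 = innerKeys-within c N m e h1 (≤-pred h2)

innerKeys𝕒-class𝕓 : ∀ N m e → filterᵇ (inClass 𝕓 e) (innerKeys 𝕒 N m) ≡ []
innerKeys𝕒-class𝕓 N zero e = refl
innerKeys𝕒-class𝕓 N (suc m) e = innerKeys𝕒-class𝕓 N m e

innerKeys𝕓-class𝕒 : ∀ N m e → filterᵇ (inClass 𝕒 e) (innerKeys 𝕓 N m) ≡ []
innerKeys𝕓-class𝕒 N zero e = refl
innerKeys𝕓-class𝕒 N (suc m) e = innerKeys𝕓-class𝕒 N m e

runKeys𝕒-class𝕓 : ∀ m N p e → filterᵇ (inClass 𝕓 e) (runKeys 𝕒 m N p) ≡ []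
runKeys𝕒-class𝕓 zero N p e = refl
runKeys𝕒-class𝕓 (suc m) N p e = innerKeys𝕒-class𝕓 N m e

runKeys𝕓-class𝕒 : ∀ m N p e → filterᵇ (inClass 𝕒 e) (runKeys 𝕓 m N p) ≡ []
runKeys𝕓-class𝕒 zero N p e = refl
runKeys𝕓-class𝕒 (suc m) N p e = innerKeys𝕓-class𝕒 N m e

catBlocks : (ℕ → ℕ → List Key) → (ℕ → List Key) → ℕ → ℕ → List Key
catBlocks bc fc a zero = fc a
catBlocks bc fc a (suc n) = bc a n ++ catBlocks bc fc (suc a) n

++-assoc₆ : ∀ {A : Set} (R1 R2 R3 R4 R5 R6 rest : List A) → R1 ++ R2 ++ R3 ++ R4 ++ R5 ++ R6 ++ rest ≡ (R1 ++ R2 ++ R3 ++ R4 ++ R5 ++ R6 ++ []) ++ rest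
++-assoc₆ R1 R2 R3 R4 R5 R6 rest =
  sym (trans (++-assoc R1 _ rest) (cong (R1 ++_) (trans (++-assoc R2 _ rest) (cong (R2 ++_) (trans (++-assoc R3 _ rest)
    (cong (R3 ++_) (trans (++-assoc R4 _ rest) (cong (R4 ++_) (trans (++-assoc R5 _ rest) (cong (R5 ++_) (++-assoc R6 [] rest)))))))))))

filterᵇ-++₆ : ∀ {A : Set} (p : A → Bool) (R1 R2 R3 R4 R5 R6 rest : List A) → filterᵇ p (R1 ++ R2 ++ R3 ++ R4 ++ R5 ++ R6 ++ rest) ≡ filterᵇ p R1 ++ filterᵇ p R2 ++ filterᵇ p R3 ++ filterᵇ p R4 ++ filterᵇ p R5 ++ filterᵇ p R6 ++ filterᵇ p rest
filterᵇ-++₆ p R1 R2 R3 R4 R5 R6 rest =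
  trans (filterᵇ-++ p R1 _) (cong (filterᵇ p R1 ++_) (trans (filterᵇ-++ p R2 _) (cong (filterᵇ p R2 ++_) (trans (filterᵇ-++ p R3 _)
    (cong (filterᵇ p R3 ++_) (trans (filterᵇ-++ p R4 _) (cong (filterᵇ p R4 ++_) (trans (filterᵇ-++ p R5 _) (cong (filterᵇ p R5 ++_) (filterᵇ-++ p R6 rest))))))))))

filterᵇ-blocksKeys : ∀ p a n K → filterᵇ p (blocksKeys a n K) ≡ catBlocks (λ a n → filterᵇ p (blockKeys a n K [])) (λ a → filterᵇ p (finalKeys a K)) a n
filterᵇ-blocksKeys p a zero K = refl
filterᵇ-blocksKeys p a (suc n) K =
  trans (cong (filterᵇ p) (++-assoc₆ (runKeys 𝕒 a (next₁ a) 𝕓) (runKeys 𝕓 (2 + a) (next₂ a) 𝕒) (runKeys 𝕒 3 (next₃ a) 𝕓) (runKeys 𝕓 (2 + a) (next₄ a n K) 𝕒) (runKeys 𝕒 1 (next₅ a n K) 𝕓) (runKeys 𝕓 1 (next₆ a n K) 𝕒) (blocksKeys (suc a) n K)))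
   (trans (filterᵇ-++ p (blockKeys a n K []) _) (cong (filterᵇ p (blockKeys a n K []) ++_) (filterᵇ-blocksKeys p (suc a) n K)))

catBlocks-cong : ∀ bc bc' fc fc' a n → (∀ a' n' → a ≤ a' → a' + suc n' ≡ a + n → bc a' n' ≡ bc' a' n') → (∀ a' → a ≤ a' → a' ≡ a + n → fc a' ≡ fc' a') → catBlocks bc fc a n ≡ catBlocks bc' fc' a n
catBlocks-cong bc bc' fc fc' a zero block-step final-step = final-step a ≤-refl (sym (+-identityʳ a))
catBlocks-cong bc bc' fc fc' a (suc n) block-step final-step =
  cong₂ _++_ (block-step a n ≤-refl refl)
   (catBlocks-cong bc bc' fc fc' (suc a) n (λ a' n' le eq → block-step a' n' (≤-trans (n≤1+n a) le) (trans eq (sym (+-suc a n))))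
     (λ a' le eq → final-step a' (≤-trans (n≤1+n a) le) (trans eq (sym (+-suc a n)))))

catBlocks-skip : ∀ bc fc e → (∀ a' n' → a' < e → bc a' n' ≡ []) → ∀ d a n → a + d ≤ e → catBlocks bc fc a (d + n) ≡ catBlocks bc fc (a + d) n
catBlocks-skip bc fc e h zero a n le = cong (λ x → catBlocks bc fc x n) (sym (+-identityʳ a))
catBlocks-skip bc fc e h (suc d) a n le =
  trans (cong (_++ catBlocks bc fc (suc a) (d + n)) (h a (d + n) (≤-trans (s≤s (m≤m+n a d)) (≤-trans (≤-reflexive (sym (+-suc a d))) le))))
   (trans (catBlocks-skip bc fc e h d (suc a) n (≤-trans (≤-reflexive (sym (+-suc a d))) le)) (cong (λ x → catBlocks bc fc x n) (sym (+-suc a d))))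

filterᵇ-blockKeys-𝕒 : ∀ e a n K → filterᵇ (inClass 𝕒 e) (blockKeys a n K []) ≡
  filterᵇ (inClass 𝕒 e) (runKeys 𝕒 a (next₁ a) 𝕓) ++ filterᵇ (inClass 𝕒 e) (runKeys 𝕒 3 (next₃ a) 𝕓) ++ filterᵇ (inClass 𝕒 e) (runKeys 𝕒 1 (next₅ a n K) 𝕓)
filterᵇ-blockKeys-𝕒 e a n K =
  trans (filterᵇ-++₆ (inClass 𝕒 e) (runKeys 𝕒 a (next₁ a) 𝕓) (runKeys 𝕓 (2 + a) (next₂ a) 𝕒) (runKeys 𝕒 3 (next₃ a) 𝕓) (runKeys 𝕓 (2 + a) (next₄ a n K) 𝕒) (runKeys 𝕒 1 (next₅ a n K) 𝕓) (runKeys 𝕓 1 (next₆ a n K) 𝕒) [])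
   (cong₂ (λ x y → filterᵇ (inClass 𝕒 e) (runKeys 𝕒 a (next₁ a) 𝕓) ++ x ++ filterᵇ (inClass 𝕒 e) (runKeys 𝕒 3 (next₃ a) 𝕓) ++ y)
     (runKeys𝕓-class𝕒 (2 + a) (next₂ a) 𝕒 e)
     (trans (cong₂ (λ x y → x ++ filterᵇ (inClass 𝕒 e) (runKeys 𝕒 1 (next₅ a n K) 𝕓) ++ y ++ []) (runKeys𝕓-class𝕒 (2 + a) (next₄ a n K) 𝕒 e) (runKeys𝕓-class𝕒 1 (next₆ a n K) 𝕒 e))
       (++-identityʳ _)))

filterᵇ-blockKeys-𝕓 : ∀ e a n K → filterᵇ (inClass 𝕓 e) (blockKeys a n K []) ≡
  filterᵇ (inClass 𝕓 e) (runKeys 𝕓 (2 + a) (next₂ a) 𝕒) ++ filterᵇ (inClass 𝕓 e) (runKeys 𝕓 (2 + a) (next₄ a n K) 𝕒) ++ filterᵇ (inClass 𝕓 e) (runKeys 𝕓 1 (next₆ a n K) 𝕒)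
filterᵇ-blockKeys-𝕓 e a n K =
  trans (filterᵇ-++₆ (inClass 𝕓 e) (runKeys 𝕒 a (next₁ a) 𝕓) (runKeys 𝕓 (2 + a) (next₂ a) 𝕒) (runKeys 𝕒 3 (next₃ a) 𝕓) (runKeys 𝕓 (2 + a) (next₄ a n K) 𝕒) (runKeys 𝕒 1 (next₅ a n K) 𝕓) (runKeys 𝕓 1 (next₆ a n K) 𝕒) [])
   (trans (cong₂ (λ x y → x ++ filterᵇ (inClass 𝕓 e) (runKeys 𝕓 (2 + a) (next₂ a) 𝕒) ++ y) (runKeys𝕒-class𝕓 a (next₁ a) 𝕓 e)
      (cong₂ (λ x y → x ++ filterᵇ (inClass 𝕓 e) (runKeys 𝕓 (2 + a) (next₄ a n K) 𝕒) ++ y) (runKeys𝕒-class𝕓 3 (next₃ a) 𝕓 e)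
        (cong (λ x → x ++ filterᵇ (inClass 𝕓 e) (runKeys 𝕓 1 (next₆ a n K) 𝕒) ++ []) (runKeys𝕒-class𝕓 1 (next₅ a n K) 𝕓 e))))
    (cong (λ x → filterᵇ (inClass 𝕓 e) (runKeys 𝕓 (2 + a) (next₂ a) 𝕒) ++ filterᵇ (inClass 𝕓 e) (runKeys 𝕓 (2 + a) (next₄ a n K) 𝕒) ++ x) (++-identityʳ _)))

filterᵇ-finalKeys-𝕒 : ∀ e a K → filterᵇ (inClass 𝕒 e) (finalKeys a K) ≡ filterᵇ (inClass 𝕒 e) (runKeys 𝕒 a (nextFinal K) 𝕓)
filterᵇ-finalKeys-𝕒 e a K = trans (filterᵇ-++ (inClass 𝕒 e) (runKeys 𝕒 a (nextFinal K) 𝕓) _) (trans (cong (filterᵇ (inClass 𝕒 e) (runKeys 𝕒 a (nextFinal K) 𝕓) ++_) (runKeys𝕓-class𝕒 K initialRuns 𝕒 e)) (++-identityʳ _))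

filterᵇ-finalKeys-𝕓 : ∀ e a K → filterᵇ (inClass 𝕓 e) (finalKeys a K) ≡ filterᵇ (inClass 𝕓 e) (runKeys 𝕓 K initialRuns 𝕒)
filterᵇ-finalKeys-𝕓 e a K = trans (filterᵇ-++ (inClass 𝕓 e) (runKeys 𝕒 a (nextFinal K) 𝕓) _) (cong (_++ filterᵇ (inClass 𝕓 e) (runKeys 𝕓 K initialRuns 𝕒)) (runKeys𝕒-class𝕓 a (nextFinal K) 𝕓 e))

catUp : (ℕ → ℕ → List Key) → ℕ → ℕ → List Key
catUp g a zero = []
catUp g a (suc n) = g a n ++ catUp g (suc a) n

catDown : (ℕ → ℕ → List Key) → ℕ → ℕ → List Key
catDown g a zero = []
catDown g a (suc n) = catDown g (suc a) n ++ g a n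

catUp↭catDown : ∀ g a n → catUp g a n ↭ catDown g a n
catUp↭catDown g a zero = ↭-refl
catUp↭catDown g a (suc n) = ↭-trans (++⁺ˡ (g a n) (catUp↭catDown g (suc a) n)) (++-comm (g a n) _)

catBlocks-unzip : ∀ f g fc a n → catBlocks (λ a n → f a n ++ g a n) fc a n ↭ catUp g a n ++ catBlocks f fc a n
catBlocks-unzip f g fc a zero = ↭-refl
catBlocks-unzip f g fc a (suc n) =
  ↭-trans (↭-reflexive (++-assoc (f a n) (g a n) _))
  (↭-trans (++⁺ˡ (f a n) (++⁺ˡ (g a n) (catBlocks-unzip f g fc (suc a) n)))
  (↭-trans (++⁺ˡ (f a n) (↭-reflexive (sym (++-assoc (g a n) _ _))))
  (shifts (f a n) (g a n ++ catUp g (suc a) n))))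

catBlocks-const : ∀ f X a n → catBlocks f (λ _ → X) a n ≡ catUp f a n ++ X
catBlocks-const f X a zero = refl
catBlocks-const f X a (suc n) = trans (cong (f a n ++_) (catBlocks-const f X (suc a) n)) (sym (++-assoc (f a n) _ X))

catUp-unzip : ∀ f g a n → catUp (λ a n → f a n ++ g a n) a n ↭ catUp f a n ++ catUp g a n
catUp-unzip f g a zero = ↭-refl
catUp-unzip f g a (suc n) =
  ↭-trans (↭-reflexive (++-assoc (f a n) (g a n) _))
  (↭-trans (++⁺ˡ (f a n) (++⁺ˡ (g a n) (catUp-unzip f g (suc a) n)))
  (↭-trans (++⁺ˡ (f a n) (shifts (g a n) (catUp f (suc a) n)))
   (↭-reflexive (sym (++-assoc (f a n) (catUp f (suc a) n) _)))))

lastLetters-catUp : ∀ (g : ℕ → ℕ → Key) (c : Letter) → (∀ a n → proj₂ (g a n) ≡ c) → ∀ a n → map proj₂ (catUp (λ a n → g a n ∷ []) a n) ≡ c ^ᴸ n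
lastLetters-catUp g c h a zero = refl
lastLetters-catUp g c h a (suc n) = cong₂ _∷_ (h a n) (lastLetters-catUp g c h (suc a) n)

lastLetters-catDown : ∀ (g : ℕ → ℕ → Key) (c : Letter) → (∀ a n → proj₂ (g a n) ≡ c) → ∀ a n → map proj₂ (catDown (λ a n → g a n ∷ []) a n) ≡ c ^ᴸ n
lastLetters-catDown g c h a zero = refl
lastLetters-catDown g c h a (suc n) = trans (map-++ proj₂ (catDown (λ a n → g a n ∷ []) (suc a) n) _)
  (trans (cong₂ (λ x y → x ++ y ∷ []) (lastLetters-catDown g c h (suc a) n) (h a n)) (^ᴸ-snoc c n))

ChainFrom-catBlocks : ∀ (G : ℕ → Key → Set) bc fc T →
  (∀ a n z → a + suc n ≡ T → G a z → ChainFrom z (bc a n) × G (suc a) (lastKey z (bc a n))) →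
  (∀ a z → a ≡ T → G a z → ChainFrom z (fc a)) →
  ∀ a n z → a + n ≡ T → G a z → ChainFrom z (catBlocks bc fc a n)
ChainFrom-catBlocks G bc fc T block-step final-step a zero z eq g = final-step a z (trans (sym (+-identityʳ a)) eq) g
ChainFrom-catBlocks G bc fc T block-step final-step a (suc n) z eq g =
  ChainFrom-++ z (bc a n) _ (proj₁ (block-step a n z eq g)) (ChainFrom-catBlocks G bc fc T block-step final-step (suc a) n _ (trans (sym (+-suc a n)) eq) (proj₂ (block-step a n z eq g)))

ChainFrom-catUp : ∀ (G : ℕ → Key → Set) g T →
  (∀ a n z → a + suc n ≡ T → G a z → ChainFrom z (g a n) × G (suc a) (lastKey z (g a n))) →
  ∀ a n z → a + n ≡ T → G a z → ChainFrom z (catUp g a n) × G (a + n) (lastKey z (catUp g a n))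
ChainFrom-catUp G g T block-step a zero z eq gz = chain[-] z , subst (λ x → G x z) (sym (+-identityʳ a)) gz
ChainFrom-catUp G g T block-step a (suc n) z eq gz =
  ChainFrom-++ z (g a n) _ (proj₁ (block-step a n z eq gz)) (proj₁ ih) ,
  subst (λ w → G (a + suc n) w) (sym (lastKey-++ z (g a n) _)) (subst (λ x → G x (lastKey (lastKey z (g a n)) (catUp g (suc a) n))) (sym (+-suc a n)) (proj₂ ih))
  where
  ih = ChainFrom-catUp G g T block-step (suc a) n _ (trans (sym (+-suc a n)) eq) (proj₂ (block-step a n z eq gz))

ChainFrom-catDown : ∀ (g : ℕ → ℕ → Key) (Top : ℕ → Key → Set) →
  (∀ a n → RunsBelow (proj₁ (g (suc a) n)) (proj₁ (g a (suc n)))) →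
  ∀ a n z → Top (a + n) z → (∀ b z → Top b z → RunsBelow (proj₁ z) (proj₁ (g b 0))) →
  ChainFrom z (catDown (λ a n → g a n ∷ []) a (suc n)) × (lastKey z (catDown (λ a n → g a n ∷ []) a (suc n)) ≡ g a n)
ChainFrom-catDown g Top st a zero z tp tz = ChainFrom-[-] (tz a z (subst (λ x → Top x z) (+-identityʳ a) tp)) , refl
ChainFrom-catDown g Top st a (suc n) z tp tz =
  ChainFrom-++ z (catDown G (suc a) (suc n)) (g a (suc n) ∷ []) (proj₁ ih) (subst (λ w → ChainFrom w (g a (suc n) ∷ [])) (sym (proj₂ ih)) (ChainFrom-[-] (st a n))) ,
  trans (lastKey-++ z (catDown G (suc a) (suc n)) _) refl
  where
  G = λ a n → g a n ∷ []
  ih = ChainFrom-catDown g Top st (suc a) n z (subst (λ x → Top x z) (+-suc a n) tp) tz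

-- The sorted classes

k₁ : ℕ → ℕ → Letter → Key
k₁ e a l = key 𝕒 e (next₁ a) l

k₂ : ℕ → ℕ → Letter → Key
k₂ j a l = key 𝕓 j (next₂ a) l

k₃ : ℕ → ℕ → Letter → Key
k₃ e a l = key 𝕒 e (next₃ a) l

k₄ : ℕ → ℕ → ℕ → ℕ → Letter → Key
k₄ j a n K l = key 𝕓 j (next₄ a n K) l

k₅ : ℕ → ℕ → ℕ → Key
k₅ a n K = key 𝕒 1 (next₅ a n K) 𝕓

k₆ : ℕ → ℕ → ℕ → Key
k₆ a n K = key 𝕓 1 (next₆ a n K) 𝕒

kFinalA : ℕ → ℕ → Letter → Key
kFinalA e K l = key 𝕒 e (nextFinal K) l

kFinalB : ℕ → Letter → Key
kFinalB j l = key 𝕓 j initialRuns l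

LongerA : ℕ → Key → Set
LongerA e z = Σ ℕ λ e' → Σ (List Run) λ rest → Σ Letter λ l → (z ≡ (((𝕒 , e') ∷ rest) , l)) × (e < e')

ShorterB : ℕ → Key → Set
ShorterB j z = Σ ℕ λ j' → Σ ℕ λ p → Σ (List Run) λ rest → Σ Letter λ l → (z ≡ (((𝕓 , j') ∷ (𝕒 , p) ∷ rest) , l)) × (j' < j) × (1 ≤ p)

InSomeA : Key → Set
InSomeA z = Σ ℕ λ e' → Σ (List Run) λ rest → Σ Letter λ l → (z ≡ (((𝕒 , e') ∷ rest) , l)) × (1 ≤ e')

sortedA≥4 : ℕ → ℕ → ℕ → List Key
sortedA≥4 e zero K = kFinalA e K 𝕓 ∷ []
sortedA≥4 e (suc r) K = k₁ e e 𝕓 ∷ catBlocks (λ a _ → k₁ e a 𝕒 ∷ []) (λ _ → kFinalA e K 𝕒 ∷ []) (suc e) r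

filterᵇ-blockKeys-𝕒≥4 : ∀ e a n K → 4 ≤ e → filterᵇ (inClass 𝕒 e) (blockKeys a n K []) ≡ filterᵇ (inClass 𝕒 e) (runKeys 𝕒 a (next₁ a) 𝕓)
filterᵇ-blockKeys-𝕒≥4 e a n K h = trans (filterᵇ-blockKeys-𝕒 e a n K) (trans (cong₂ (λ x y → filterᵇ (inClass 𝕒 e) (runKeys 𝕒 a (next₁ a) 𝕓) ++ x ++ y) (runKeys-above 𝕒 3 (next₃ a) 𝕓 e h) (runKeys-above 𝕒 1 (next₅ a n K) 𝕓 e (≤-trans (s≤s (s≤s z≤n)) h))) (++-identityʳ _))

class-sortedA≥4 : ∀ e r K → 4 ≤ e → filterᵇ (inClass 𝕒 e) (blocksKeys 0 (e + r) K) ≡ sortedA≥4 e r K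
class-sortedA≥4 e r K h =
  trans (filterᵇ-blocksKeys (inClass 𝕒 e) 0 (e + r) K)
   (trans (catBlocks-skip bc fc e (λ a' n' lt → trans (filterᵇ-blockKeys-𝕒≥4 e a' n' K h) (runKeys-above 𝕒 a' (next₁ a') 𝕓 e lt)) e 0 r ≤-refl)
    (from r))
  where
  bc = λ a n → filterᵇ (inClass 𝕒 e) (blockKeys a n K [])
  fc = λ a → filterᵇ (inClass 𝕒 e) (finalKeys a K)
  from : ∀ r → catBlocks bc fc e r ≡ sortedA≥4 e r K
  from zero = trans (filterᵇ-finalKeys-𝕒 e e K) (runKeys-top 𝕒 e (nextFinal K) 𝕓 (≤-trans (s≤s z≤n) h))
  from (suc r) = cong₂ _++_ (trans (filterᵇ-blockKeys-𝕒≥4 e e r K h) (runKeys-top 𝕒 e (next₁ e) 𝕓 (≤-trans (s≤s z≤n) h)))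
    (catBlocks-cong bc _ fc _ (suc e) r (λ a' n' le _ → trans (filterᵇ-blockKeys-𝕒≥4 e a' n' K h) (runKeys-within 𝕒 a' (next₁ a') 𝕓 e (≤-trans (s≤s z≤n) h) le))
      (λ a' le _ → trans (filterᵇ-finalKeys-𝕒 e a' K) (runKeys-within 𝕒 a' (nextFinal K) 𝕓 e (≤-trans (s≤s z≤n) h) le)))

lastLetters-sortedA≥4 : ∀ e r K → map proj₂ (sortedA≥4 e r K) ≡ 𝕓 ∷ 𝕒 ^ᴸ r
lastLetters-sortedA≥4 e zero K = refl
lastLetters-sortedA≥4 e (suc r) K = cong (𝕓 ∷_) (blocks (suc e) r)
  where
  blocks : ∀ a r → map proj₂ (catBlocks (λ a _ → k₁ e a 𝕒 ∷ []) (λ _ → kFinalA e K 𝕒 ∷ []) a r) ≡ 𝕒 ^ᴸ suc r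
  blocks a zero = refl
  blocks a (suc r) = cong (𝕒 ∷_) (blocks (suc a) r)

BelowBlockA : ℕ → ℕ → Key → Set
BelowBlockA e a z = Σ ℕ λ q → Σ (List Run) λ rest → Σ Letter λ l → (z ≡ (((𝕒 , e) ∷ (𝕓 , q) ∷ (𝕒 , 3) ∷ rest) , l)) × (q < 2 + a)

chainFrom-sortedA≥4 : ∀ e r K → K ≡ 3 + (e + r) → ∀ z → LongerA e z → ChainFrom z (sortedA≥4 e r K)
chainFrom-sortedA≥4 e zero K hK z (e' , rest , l , refl , lt) = ChainFrom-[-] (longer lt refl (subst (1 ≤_) (sym hK) (s≤s z≤n)))
chainFrom-sortedA≥4 e (suc r) K hK z (e' , rest , l , refl , lt) =
  chain∷ (longer lt refl (s≤s z≤n))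
   (ChainFrom-catBlocks (BelowBlockA e) _ _ (e + suc r) block-step final-step (suc e) r (k₁ e e 𝕓) (sym (+-suc e r)) (2 + e , _ , 𝕓 , refl , ≤-refl))
  where
  block-step : ∀ a n z → a + suc n ≡ e + suc r → BelowBlockA e a z → ChainFrom z (k₁ e a 𝕒 ∷ []) × BelowBlockA e (suc a) (lastKey z (k₁ e a 𝕒 ∷ []))
  block-step a n z _ (q , rest , l , refl , lt) = ChainFrom-[-] (same (shorter lt refl (s≤s z≤n))) , (2 + a , _ , 𝕒 , refl , ≤-refl)
  final-step : ∀ a z → a ≡ e + suc r → BelowBlockA e a z → ChainFrom z (kFinalA e K 𝕒 ∷ [])
  final-step a z eq (q , rest , l , refl , lt) = ChainFrom-[-] (same (shorter (≤-trans lt (≤-trans (n≤1+n (2 + a)) (≤-reflexive (trans (cong (3 +_) eq) (sym hK))))) refl (s≤s z≤n)))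

sortedA3 : ℕ → ℕ → List Key
sortedA3 t K = k₃ 3 0 𝕓 ∷ k₃ 3 1 𝕓 ∷ k₃ 3 2 𝕓 ∷ k₁ 3 3 𝕓 ∷ k₃ 3 3 𝕓 ∷ catBlocks (λ a _ → k₁ 3 a 𝕒 ∷ k₃ 3 a 𝕓 ∷ []) (λ _ → kFinalA 3 K 𝕒 ∷ []) 4 t

class-sortedA3 : ∀ t K → filterᵇ (inClass 𝕒 3) (blocksKeys 0 (4 + t) K) ≡ sortedA3 t K
class-sortedA3 t K = trans (filterᵇ-blocksKeys (inClass 𝕒 3) 0 (4 + t) K)
  (cong (λ x → k₃ 3 0 𝕓 ∷ k₃ 3 1 𝕓 ∷ k₃ 3 2 𝕓 ∷ k₁ 3 3 𝕓 ∷ k₃ 3 3 𝕓 ∷ x)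
    (catBlocks-cong _ _ _ _ 4 t
      (λ a n le _ → trans (filterᵇ-blockKeys-𝕒 3 a n K) (trans (cong₂ (λ x y → x ++ y ++ filterᵇ (inClass 𝕒 3) (runKeys 𝕒 1 (next₅ a n K) 𝕓)) (runKeys-within 𝕒 a (next₁ a) 𝕓 3 z<s le) (runKeys-top 𝕒 3 (next₃ a) 𝕓 z<s)) refl))
      (λ a le _ → trans (filterᵇ-finalKeys-𝕒 3 a K) (runKeys-within 𝕒 a (nextFinal K) 𝕓 3 z<s le))))

lastLetters-sortedA3 : ∀ t K → map proj₂ (sortedA3 t K) ≡ 𝕓 ^ᴸ 5 ++ pow (𝕒 ∷ 𝕓 ∷ []) t ++ 𝕒 ∷ []
lastLetters-sortedA3 t K = cong (λ x → 𝕓 ∷ 𝕓 ∷ 𝕓 ∷ 𝕓 ∷ 𝕓 ∷ x) (blocks 4 t)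
  where
  blocks : ∀ a t → map proj₂ (catBlocks (λ a _ → k₁ 3 a 𝕒 ∷ k₃ 3 a 𝕓 ∷ []) (λ _ → kFinalA 3 K 𝕒 ∷ []) a t) ≡ pow (𝕒 ∷ 𝕓 ∷ []) t ++ 𝕒 ∷ []
  blocks a zero = refl
  blocks a (suc t) = cong (λ x → 𝕒 ∷ 𝕓 ∷ x) (blocks (suc a) t)

BelowBlockA3 : ℕ → Key → Set
BelowBlockA3 a z = Σ ℕ λ q → Σ (List Run) λ rest → Σ Letter λ l → (z ≡ (((𝕒 , 3) ∷ (𝕓 , q) ∷ (𝕒 , 1) ∷ rest) , l)) × (q < 2 + a)

chainFrom-sortedA3 : ∀ t K → K ≡ 7 + t → ∀ z → LongerA 3 z → ChainFrom z (sortedA3 t K)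
chainFrom-sortedA3 t K hK z (e' , rest , l , refl , lt) =
  chain∷ (longer lt refl z<s) (chain∷ (same (shorter (s≤s (s≤s (s≤s z≤n))) refl z<s)) (chain∷ (same (shorter (s≤s (s≤s (s≤s (s≤s z≤n)))) refl z<s))
   (chain∷ (same (shorter ≤-refl refl z<s)) (chain∷ (same (same (longer (s≤s (s≤s z≤n)) refl z<s)))
    (ChainFrom-catBlocks BelowBlockA3 _ _ (4 + t) block-step final-step 4 t (k₃ 3 3 𝕓) refl (5 , _ , 𝕓 , refl , ≤-refl))))))
  where
  block-step : ∀ a n z → a + suc n ≡ 4 + t → BelowBlockA3 a z → ChainFrom z (k₁ 3 a 𝕒 ∷ k₃ 3 a 𝕓 ∷ []) × BelowBlockA3 (suc a) (lastKey z (k₁ 3 a 𝕒 ∷ k₃ 3 a 𝕓 ∷ []))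
  block-step a n z _ (q , rest , l , refl , lt) = chain∷ (same (shorter lt refl z<s)) (chain∷ (same (same (longer (s≤s (s≤s z≤n)) refl z<s))) (chain[-] _)) , (2 + a , _ , 𝕓 , refl , ≤-refl)
  final-step : ∀ a z → a ≡ 4 + t → BelowBlockA3 a z → ChainFrom z (kFinalA 3 K 𝕒 ∷ [])
  final-step a z eq (q , rest , l , refl , lt) = ChainFrom-[-] (same (shorter (≤-trans lt (≤-trans (n≤1+n (2 + a)) (≤-reflexive (trans (cong (3 +_) eq) (sym hK))))) refl z<s))

sortedA2 : ℕ → ℕ → List Key
sortedA2 t K = k₃ 2 0 𝕒 ∷ k₃ 2 1 𝕒 ∷ k₁ 2 2 𝕓 ∷ k₃ 2 2 𝕒 ∷ k₁ 2 3 𝕒 ∷ k₃ 2 3 𝕒 ∷ catBlocks (λ a _ → k₁ 2 a 𝕒 ∷ k₃ 2 a 𝕒 ∷ []) (λ _ → kFinalA 2 K 𝕒 ∷ []) 4 t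

class-sortedA2 : ∀ t K → filterᵇ (inClass 𝕒 2) (blocksKeys 0 (4 + t) K) ≡ sortedA2 t K
class-sortedA2 t K = trans (filterᵇ-blocksKeys (inClass 𝕒 2) 0 (4 + t) K)
  (cong (λ x → k₃ 2 0 𝕒 ∷ k₃ 2 1 𝕒 ∷ k₁ 2 2 𝕓 ∷ k₃ 2 2 𝕒 ∷ k₁ 2 3 𝕒 ∷ k₃ 2 3 𝕒 ∷ x)
    (catBlocks-cong _ _ _ _ 4 t
      (λ a n le _ → trans (filterᵇ-blockKeys-𝕒 2 a n K) (trans (cong₂ (λ x y → x ++ y ++ filterᵇ (inClass 𝕒 2) (runKeys 𝕒 1 (next₅ a n K) 𝕓)) (runKeys-within 𝕒 a (next₁ a) 𝕓 2 z<s (≤-trans (s≤s (s≤s (s≤s z≤n))) le)) (runKeys-within 𝕒 3 (next₃ a) 𝕓 2 z<s ≤-refl)) refl))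
      (λ a le _ → trans (filterᵇ-finalKeys-𝕒 2 a K) (runKeys-within 𝕒 a (nextFinal K) 𝕓 2 z<s (≤-trans (s≤s (s≤s (s≤s z≤n))) le)))))

lastLetters-sortedA2 : ∀ t K → map proj₂ (sortedA2 t K) ≡ 𝕒 ∷ 𝕒 ∷ 𝕓 ∷ 𝕒 ^ᴸ (4 + (t + t))
lastLetters-sortedA2 t K = cong (λ x → 𝕒 ∷ 𝕒 ∷ 𝕓 ∷ 𝕒 ∷ 𝕒 ∷ 𝕒 ∷ x) (blocks 4 t)
  where
  blocks : ∀ a t → map proj₂ (catBlocks (λ a _ → k₁ 2 a 𝕒 ∷ k₃ 2 a 𝕒 ∷ []) (λ _ → kFinalA 2 K 𝕒 ∷ []) a t) ≡ 𝕒 ^ᴸ suc (t + t)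
  blocks a zero = refl
  blocks a (suc t) = trans (cong (λ x → 𝕒 ∷ 𝕒 ∷ x) (blocks (suc a) t)) (cong (λ x → 𝕒 ^ᴸ suc (suc x)) (sym (+-suc t t)))

BelowBlockA2 : ℕ → Key → Set
BelowBlockA2 a z = Σ ℕ λ q → Σ (List Run) λ rest → Σ Letter λ l → (z ≡ (((𝕒 , 2) ∷ (𝕓 , q) ∷ (𝕒 , 1) ∷ rest) , l)) × (q < 2 + a)

chainFrom-sortedA2 : ∀ t K → K ≡ 7 + t → ∀ z → LongerA 2 z → ChainFrom z (sortedA2 t K)
chainFrom-sortedA2 t K hK z (e' , rest , l , refl , lt) =
  chain∷ (longer lt refl z<s) (chain∷ (same (shorter (s≤s (s≤s (s≤s z≤n))) refl z<s)) (chain∷ (same (shorter (s≤s (s≤s (s≤s (s≤s z≤n)))) refl z<s))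
   (chain∷ (same (same (longer (s≤s (s≤s z≤n)) refl z<s))) (chain∷ (same (shorter ≤-refl refl z<s)) (chain∷ (same (same (longer (s≤s (s≤s z≤n)) refl z<s)))
    (ChainFrom-catBlocks BelowBlockA2 _ _ (4 + t) block-step final-step 4 t (k₃ 2 3 𝕒) refl (5 , _ , 𝕒 , refl , ≤-refl)))))))
  where
  block-step : ∀ a n z → a + suc n ≡ 4 + t → BelowBlockA2 a z → ChainFrom z (k₁ 2 a 𝕒 ∷ k₃ 2 a 𝕒 ∷ []) × BelowBlockA2 (suc a) (lastKey z (k₁ 2 a 𝕒 ∷ k₃ 2 a 𝕒 ∷ []))
  block-step a n z _ (q , rest , l , refl , lt) = chain∷ (same (shorter lt refl z<s)) (chain∷ (same (same (longer (s≤s (s≤s z≤n)) refl z<s))) (chain[-] _)) , (2 + a , _ , 𝕒 , refl , ≤-refl)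
  final-step : ∀ a z → a ≡ 4 + t → BelowBlockA2 a z → ChainFrom z (kFinalA 2 K 𝕒 ∷ [])
  final-step a z eq (q , rest , l , refl , lt) = ChainFrom-[-] (same (shorter (≤-trans lt (≤-trans (n≤1+n (2 + a)) (≤-reflexive (trans (cong (3 +_) eq) (sym hK))))) refl z<s))

sortedA1 : ℕ → ℕ → List Key
sortedA1 t K = catDown (λ a n → k₅ a n K ∷ []) 0 (4 + t) ++
  k₁ 1 0 𝕓 ∷ k₃ 1 0 𝕒 ∷ k₁ 1 1 𝕓 ∷ k₃ 1 1 𝕒 ∷ catBlocks (λ a _ → k₁ 1 a 𝕒 ∷ k₃ 1 a 𝕒 ∷ []) (λ _ → kFinalA 1 K 𝕒 ∷ []) 2 (2 + t)

class-sortedA1′ : ∀ t K → filterᵇ (inClass 𝕒 1) (k₁ 1 0 𝕓 ∷ blocksKeys 0 (4 + t) K) ≡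
  k₁ 1 0 𝕓 ∷ k₃ 1 0 𝕒 ∷ k₅ 0 (3 + t) K ∷ k₁ 1 1 𝕓 ∷ k₃ 1 1 𝕒 ∷ k₅ 1 (2 + t) K ∷
    catBlocks (λ a n → (k₁ 1 a 𝕒 ∷ k₃ 1 a 𝕒 ∷ []) ++ (k₅ a n K ∷ [])) (λ _ → kFinalA 1 K 𝕒 ∷ []) 2 (2 + t)
class-sortedA1′ t K = cong (k₁ 1 0 𝕓 ∷_) (trans (filterᵇ-blocksKeys (inClass 𝕒 1) 0 (4 + t) K)
  (cong (λ x → k₃ 1 0 𝕒 ∷ k₅ 0 (3 + t) K ∷ k₁ 1 1 𝕓 ∷ k₃ 1 1 𝕒 ∷ k₅ 1 (2 + t) K ∷ x)
    (catBlocks-cong _ _ _ _ 2 (2 + t)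
      (λ a n le _ → trans (filterᵇ-blockKeys-𝕒 1 a n K) (cong₂ (λ x y → x ++ y ++ filterᵇ (inClass 𝕒 1) (runKeys 𝕒 1 (next₅ a n K) 𝕓)) (runKeys-within 𝕒 a (next₁ a) 𝕓 1 z<s le) (runKeys-within 𝕒 3 (next₃ a) 𝕓 1 z<s (s≤s (s≤s z≤n)))))
      (λ a le _ → trans (filterᵇ-finalKeys-𝕒 1 a K) (runKeys-within 𝕒 a (nextFinal K) 𝕓 1 z<s le)))))

-- Only the keys k₅ change places: they move, in reverse order, to the front.
class-sortedA1 : ∀ t K → filterᵇ (inClass 𝕒 1) (k₁ 1 0 𝕓 ∷ blocksKeys 0 (4 + t) K) ↭ sortedA1 t K
class-sortedA1 t K =
  ↭-trans (↭-reflexive (class-sortedA1′ t K))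
  (↭-trans (prep A0 (prep C0 (prep E0 (prep A1 (prep C1 (prep E1 (catBlocks-unzip AC EE fc 2 (2 + t))))))))
  (↭-trans (shift E0 (A0 ∷ C0 ∷ []) _)
  (↭-trans (prep E0 (shift E1 (A0 ∷ C0 ∷ A1 ∷ C1 ∷ []) _))
  (↭-trans (prep E0 (prep E1 (shifts (A0 ∷ C0 ∷ A1 ∷ C1 ∷ []) EB)))
   (++⁺ʳ _ (catUp↭catDown (λ a n → k₅ a n K ∷ []) 0 (4 + t)))))))
  where
  A0 = k₁ 1 0 𝕓
  C0 = k₃ 1 0 𝕒
  E0 = k₅ 0 (3 + t) K
  A1 = k₁ 1 1 𝕓
  C1 = k₃ 1 1 𝕒
  E1 = k₅ 1 (2 + t) K
  AC = λ a (_ : ℕ) → k₁ 1 a 𝕒 ∷ k₃ 1 a 𝕒 ∷ []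
  EE = λ a n → k₅ a n K ∷ []
  fc = λ (_ : ℕ) → kFinalA 1 K 𝕒 ∷ []
  EB = catUp EE 2 (2 + t)

lastLetters-sortedA1 : ∀ t K → map proj₂ (sortedA1 t K) ≡ 𝕓 ^ᴸ (4 + t) ++ 𝕓 ∷ 𝕒 ∷ 𝕓 ∷ 𝕒 ^ᴸ (6 + (t + t))
lastLetters-sortedA1 t K = trans (map-++ proj₂ (catDown (λ a n → k₅ a n K ∷ []) 0 (4 + t)) _)
  (cong₂ _++_ (lastLetters-catDown (λ a n → k₅ a n K) 𝕓 (λ a n → refl) 0 (4 + t)) (cong (λ x → 𝕓 ∷ 𝕒 ∷ 𝕓 ∷ 𝕒 ∷ x) (trans (blocks 2 (2 + t)) (cong (λ x → 𝕒 ^ᴸ (3 + x)) (trans (+-suc t (suc t)) (cong suc (+-suc t t)))))))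
  where
  blocks : ∀ a t → map proj₂ (catBlocks (λ a _ → k₁ 1 a 𝕒 ∷ k₃ 1 a 𝕒 ∷ []) (λ _ → kFinalA 1 K 𝕒 ∷ []) a t) ≡ 𝕒 ^ᴸ suc (t + t)
  blocks a zero = refl
  blocks a (suc t) = trans (cong (λ x → 𝕒 ∷ 𝕒 ∷ x) (blocks (suc a) t)) (cong (λ x → 𝕒 ^ᴸ suc (suc x)) (sym (+-suc t t)))

BelowBlockA1 : ℕ → Key → Set
BelowBlockA1 a z = Σ ℕ λ q → Σ (List Run) λ rest → Σ Letter λ l → (z ≡ (((𝕒 , 1) ∷ (𝕓 , q) ∷ (𝕒 , 1) ∷ rest) , l)) × (q < 2 + a)

chainFrom-sortedA1 : ∀ t K → K ≡ 7 + t → ∀ z → LongerA 1 z → ChainFrom z (sortedA1 t K)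
chainFrom-sortedA1 t K hK z hz = ChainFrom-++ z (catDown (λ a n → k₅ a n K ∷ []) 0 (4 + t)) _ (proj₁ down)
  (subst (λ w → ChainFrom w _) (sym (proj₂ down))
    (chain∷ (same (shorter (s≤s (s≤s z≤n)) refl z<s)) (chain∷ (same (same (longer (s≤s (s≤s z≤n)) refl z<s))) (chain∷ (same (shorter ≤-refl refl z<s))
      (chain∷ (same (same (longer (s≤s (s≤s z≤n)) refl z<s))) (ChainFrom-catBlocks BelowBlockA1 _ _ (4 + t) block-step final-step 2 (2 + t) (k₃ 1 1 𝕒) refl (3 , _ , 𝕒 , refl , ≤-refl)))))))
  where
  down = ChainFrom-catDown (λ a n → k₅ a n K) (λ _ z → LongerA 1 z) (λ a n → same (same (longer ≤-refl refl z<s))) 0 (3 + t) z hz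
         (λ { b z (e' , rest , l , refl , lt) → longer lt refl z<s })
  block-step : ∀ a n z → a + suc n ≡ 4 + t → BelowBlockA1 a z → ChainFrom z (k₁ 1 a 𝕒 ∷ k₃ 1 a 𝕒 ∷ []) × BelowBlockA1 (suc a) (lastKey z (k₁ 1 a 𝕒 ∷ k₃ 1 a 𝕒 ∷ []))
  block-step a n z _ (q , rest , l , refl , lt) = chain∷ (same (shorter lt refl z<s)) (chain∷ (same (same (longer (s≤s (s≤s z≤n)) refl z<s))) (chain[-] _)) , (2 + a , _ , 𝕒 , refl , ≤-refl)
  final-step : ∀ a z → a ≡ 4 + t → BelowBlockA1 a z → ChainFrom z (kFinalA 1 K 𝕒 ∷ [])
  final-step a z eq (q , rest , l , refl , lt) = ChainFrom-[-] (same (shorter (≤-trans lt (≤-trans (n≤1+n (2 + a)) (≤-reflexive (trans (cong (3 +_) eq) (sym hK))))) refl z<s))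

sortedB1 : ℕ → ℕ → List Key
sortedB1 t K = catDown (λ a n → k₆ a n K ∷ []) 3 (1 + t) ++
  k₂ 1 0 𝕓 ∷ k₂ 1 1 𝕓 ∷ k₂ 1 2 𝕓 ∷ k₆ 2 (1 + t) K ∷ (catUp (λ a n → k₂ 1 a 𝕓 ∷ []) 3 (1 + t) ++
  k₆ 1 (2 + t) K ∷ (catDown (λ a n → k₄ 1 a n K 𝕓 ∷ []) 0 (4 + t) ++ kFinalB 1 𝕓 ∷ k₆ 0 (3 + t) K ∷ []))

class-sortedB1′ : ∀ t K → 2 ≤ K → filterᵇ (inClass 𝕓 1) (k₁ 1 0 𝕓 ∷ blocksKeys 0 (4 + t) K) ≡ catBlocks (λ a n → k₂ 1 a 𝕓 ∷ k₄ 1 a n K 𝕓 ∷ k₆ a n K ∷ []) (λ _ → kFinalB 1 𝕓 ∷ []) 0 (4 + t)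
class-sortedB1′ t K hK = trans (filterᵇ-blocksKeys (inClass 𝕓 1) 0 (4 + t) K)
  (catBlocks-cong _ _ _ _ 0 (4 + t)
    (λ a n le _ → trans (filterᵇ-blockKeys-𝕓 1 a n K) (cong₂ (λ x y → x ++ y ++ filterᵇ (inClass 𝕓 1) (runKeys 𝕓 1 (next₆ a n K) 𝕒)) (runKeys-within 𝕓 (2 + a) (next₂ a) 𝕒 1 z<s (s≤s (s≤s z≤n))) (runKeys-within 𝕓 (2 + a) (next₄ a n K) 𝕒 1 z<s (s≤s (s≤s z≤n)))))
    (λ a le _ → trans (filterᵇ-finalKeys-𝕓 1 a K) (runKeys-within 𝕓 K initialRuns 𝕒 1 z<s hK)))

-- The keys k₆ of blocks a ≥ 3 move, reversed, to the front; those of blocks 1, 2 and 0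
-- are placed around the keys k₂; the keys k₄ end up reversed before the final ones.
class-sortedB1 : ∀ t K → 2 ≤ K → filterᵇ (inClass 𝕓 1) (k₁ 1 0 𝕓 ∷ blocksKeys 0 (4 + t) K) ↭ sortedB1 t K
class-sortedB1 t K hK =
  ↭-trans (↭-reflexive (class-sortedB1′ t K hK))
  (↭-trans (++⁺ˡ P tailperm)
  (↭-trans (↭-reflexive (cong (P ++_) (trans (++-assoc CB (CD ++ CF) (G ∷ [])) (trans (cong (CB ++_) (++-assoc CD CF (G ∷ []))) (sym (++-assoc CB CD (CF ++ G ∷ [])))))))
  (↭-trans (shifts P' CF {G ∷ []})
  (↭-trans (++⁺ˡ CF (↭-reflexive (cong (P ++_) (++-assoc CB CD (G ∷ [])))))
  (↭-trans (++⁺ʳ _ (catUp↭catDown FF 3 (1 + t)))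
  (++⁺ˡ (catDown FF 3 (1 + t)) (prep B0 (↭-trans (shift B1 (D0 ∷ F0 ∷ []) _) (prep B1
    (↭-trans (shift B2 (D0 ∷ F0 ∷ D1 ∷ F1 ∷ []) _) (prep B2
    (↭-trans (shift F2 (D0 ∷ F0 ∷ D1 ∷ F1 ∷ D2 ∷ []) _) (prep F2
    (↭-trans (shifts (D0 ∷ F0 ∷ D1 ∷ F1 ∷ D2 ∷ []) CB {CD ++ G ∷ []}) (++⁺ˡ CB
    (↭-trans (shift F1 (D0 ∷ F0 ∷ D1 ∷ []) _) (prep F1
    (↭-trans (prep D0 (↭-trans (∷↭∷ʳ F0 (D1 ∷ D2 ∷ (CD ++ G ∷ []))) (prep D1 (prep D2 (↭-reflexive (++-assoc CD (G ∷ []) (F0 ∷ [])))))))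
     (++⁺ʳ (G ∷ F0 ∷ []) (catUp↭catDown DD 0 (4 + t)))))))))))))))))))))
  where
  BB = λ a (n : ℕ) → k₂ 1 a 𝕓 ∷ []
  DD = λ a n → k₄ 1 a n K 𝕓 ∷ []
  FF = λ a n → k₆ a n K ∷ []
  CB = catUp BB 3 (1 + t)
  CD = catUp DD 3 (1 + t)
  CF = catUp FF 3 (1 + t)
  G = kFinalB 1 𝕓
  B0 = k₂ 1 0 𝕓
  B1 = k₂ 1 1 𝕓
  B2 = k₂ 1 2 𝕓
  D0 = k₄ 1 0 (3 + t) K 𝕓
  D1 = k₄ 1 1 (2 + t) K 𝕓
  D2 = k₄ 1 2 (1 + t) K 𝕓
  F0 = k₆ 0 (3 + t) K
  F1 = k₆ 1 (2 + t) K
  F2 = k₆ 2 (1 + t) K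
  P = B0 ∷ D0 ∷ F0 ∷ B1 ∷ D1 ∷ F1 ∷ B2 ∷ D2 ∷ F2 ∷ []
  P' = P ++ (CB ++ CD)
  tailperm : catBlocks (λ a n → k₂ 1 a 𝕓 ∷ k₄ 1 a n K 𝕓 ∷ k₆ a n K ∷ []) (λ _ → G ∷ []) 3 (1 + t) ↭ (CB ++ (CD ++ CF)) ++ G ∷ []
  tailperm = ↭-trans (↭-reflexive (catBlocks-const (λ a n → BB a n ++ (DD a n ++ FF a n)) (G ∷ []) 3 (1 + t)))
    (++⁺ʳ (G ∷ []) (↭-trans (catUp-unzip BB (λ a n → DD a n ++ FF a n) 3 (1 + t)) (++⁺ˡ CB (catUp-unzip DD FF 3 (1 + t)))))

lastLetters-sortedB1 : ∀ t K → map proj₂ (sortedB1 t K) ≡ 𝕒 ^ᴸ (1 + t) ++ 𝕓 ∷ 𝕓 ∷ 𝕓 ∷ 𝕒 ∷ 𝕓 ^ᴸ (1 + t) ++ 𝕒 ∷ 𝕓 ^ᴸ (4 + t) ++ 𝕓 ∷ 𝕒 ∷ []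
lastLetters-sortedB1 t K =
  trans (map-++ proj₂ (catDown FF 3 (1 + t)) _)
  (cong₂ _++_ (lastLetters-catDown (λ a n → k₆ a n K) 𝕒 (λ a n → refl) 3 (1 + t))
   (cong (λ x → 𝕓 ∷ 𝕓 ∷ 𝕓 ∷ 𝕒 ∷ x)
    (trans (map-++ proj₂ (catUp BB 3 (1 + t)) _)
     (cong₂ _++_ (lastLetters-catUp (λ a n → k₂ 1 a 𝕓) 𝕓 (λ a n → refl) 3 (1 + t))
      (cong (𝕒 ∷_) (trans (map-++ proj₂ (catDown DD 0 (4 + t)) _)
        (cong (_++ 𝕓 ∷ 𝕒 ∷ []) (lastLetters-catDown (λ a n → k₄ 1 a n K 𝕓) 𝕓 (λ a n → refl) 0 (4 + t)))))))))
  where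
  BB = λ a (n : ℕ) → k₂ 1 a 𝕓 ∷ []
  DD = λ a n → k₄ 1 a n K 𝕓 ∷ []
  FF = λ a n → k₆ a n K ∷ []

BelowBlockB1 : ℕ → Key → Set
BelowBlockB1 a z = Σ ℕ λ q → Σ ℕ λ p → Σ (List Run) λ rest → Σ Letter λ l → (z ≡ (((𝕓 , 1) ∷ (𝕒 , 3) ∷ (𝕓 , q) ∷ (𝕒 , p) ∷ rest) , l)) × (q < 2 + a) × (1 ≤ p)

chainFrom-sortedB1 : ∀ t K → 1 ≤ K → ∀ z → InSomeA z → ChainFrom z (sortedB1 t K)
chainFrom-sortedB1 t K hK z hz =
  ChainFrom-++ z (catDown FF 3 (1 + t)) _ (proj₁ down₁)
  (subst (λ w → ChainFrom w _) (sym (proj₂ down₁))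
   (chain∷ (same (longer (s≤s (s≤s (s≤s (s≤s z≤n)))) refl z<s)) (chain∷ (same (same (shorter (s≤s (s≤s (s≤s z≤n))) refl z<s)))
    (chain∷ (same (same (shorter ≤-refl refl z<s))) (chain∷ (same (same (shorter ≤-refl refl z<s)))
     (chain∷ (same (same (same (longer (s≤s (s≤s z≤n)) refl z<s))))
      (ChainFrom-++ (k₂ 1 3 𝕓) (catUp BB 4 t) _ (proj₁ up)
       (after (proj₂ up)))))))))
  where
  BB = λ a (n : ℕ) → k₂ 1 a 𝕓 ∷ []
  DD = λ a n → k₄ 1 a n K 𝕓 ∷ []
  FF = λ a n → k₆ a n K ∷ []
  down₁ = ChainFrom-catDown (λ a n → k₆ a n K) (λ _ z → InSomeA z) (λ a n → same (longer ≤-refl refl z<s)) 3 t z hz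
          (λ { b z (e' , rest , l , refl , le) → letter le z<s })
  up = ChainFrom-catUp BelowBlockB1 BB (4 + t) (λ { a n z _ (q , p , rest , l , refl , lt , hp) → ChainFrom-[-] (same (same (shorter lt refl hp))) , (2 + a , 1 , _ , 𝕓 , refl , ≤-refl , z<s) })
         4 t (k₂ 1 3 𝕓) refl (5 , 1 , _ , 𝕓 , refl , ≤-refl , z<s)
  down₂ = ChainFrom-catDown (λ a n → k₄ 1 a n K 𝕓) (λ _ z → Σ (List Run) λ rest → Σ Letter λ l → z ≡ (((𝕓 , 1) ∷ (𝕒 , 2) ∷ rest) , l))
          (λ a n → same (same (same (longer ≤-refl refl z<s)))) 0 (3 + t) (k₆ 1 (2 + t) K) (_ , _ , refl)
          (λ { b z (rest , l , refl) → same (longer (s≤s (s≤s z≤n)) refl z<s) })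
  after : ∀ {w} → BelowBlockB1 (4 + t) w → ChainFrom w (k₆ 1 (2 + t) K ∷ (catDown DD 0 (4 + t) ++ kFinalB 1 𝕓 ∷ k₆ 0 (3 + t) K ∷ []))
  after (q , p , rest , l , refl , lt , hp) =
    chain∷ (same (longer (s≤s (s≤s (s≤s z≤n))) refl z<s))
     (ChainFrom-++ (k₆ 1 (2 + t) K) (catDown DD 0 (4 + t)) _ (proj₁ down₂)
      (subst (λ w → ChainFrom w (kFinalB 1 𝕓 ∷ k₆ 0 (3 + t) K ∷ [])) (sym (proj₂ down₂)) (chain∷ (same (same (shorter (s≤s (s≤s z≤n)) refl z<s))) (chain∷ (same (same (shorter ≤-refl refl z<s))) (chain[-] _)))))

sortedB≥2 : ℕ → ℕ → ℕ → List Key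
sortedB≥2 K s r = k₂ (2 + s) s 𝕒 ∷ (catUp (λ a _ → k₂ (2 + s) a 𝕓 ∷ []) (suc s) r ++
  (catDown (λ a n → k₄ (2 + s) a n K 𝕓 ∷ []) (suc s) r ++ (k₄ (2 + s) s r K 𝕒 ∷ kFinalB (2 + s) 𝕓 ∷ [])))

class-sortedB≥2′ : ∀ K s r → 3 + (s + suc r) ≤ K → filterᵇ (inClass 𝕓 (2 + s)) (k₁ 1 0 𝕓 ∷ blocksKeys 0 (s + suc r) K) ≡
  (k₂ (2 + s) s 𝕒 ∷ k₄ (2 + s) s r K 𝕒 ∷ []) ++ catBlocks (λ a n → k₂ (2 + s) a 𝕓 ∷ k₄ (2 + s) a n K 𝕓 ∷ []) (λ _ → kFinalB (2 + s) 𝕓 ∷ []) (suc s) r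
class-sortedB≥2′ K s r hK =
  trans (filterᵇ-blocksKeys (inClass 𝕓 j) 0 (s + suc r) K)
  (trans (catBlocks-skip bc fc s (λ a' n' lt → trans (filterᵇ-blockKeys-𝕓 j a' n' K) (cong₂ (λ x y → x ++ y ++ filterᵇ (inClass 𝕓 j) (runKeys 𝕓 1 (next₆ a' n' K) 𝕒))
             (runKeys-above 𝕓 (2 + a') (next₂ a') 𝕒 j (s≤s (s≤s lt))) (runKeys-above 𝕓 (2 + a') (next₄ a' n' K) 𝕒 j (s≤s (s≤s lt))))) s 0 (suc r) ≤-refl)
   (cong₂ _++_ (trans (filterᵇ-blockKeys-𝕓 j s r K) (cong₂ (λ x y → x ++ y ++ filterᵇ (inClass 𝕓 j) (runKeys 𝕓 1 (next₆ s r K) 𝕒))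
             (runKeys-top 𝕓 (2 + s) (next₂ s) 𝕒 z<s) (runKeys-top 𝕓 (2 + s) (next₄ s r K) 𝕒 z<s)))
    (catBlocks-cong bc _ fc _ (suc s) r
      (λ a n le _ → trans (filterᵇ-blockKeys-𝕓 j a n K) (cong₂ (λ x y → x ++ y ++ filterᵇ (inClass 𝕓 j) (runKeys 𝕓 1 (next₆ a n K) 𝕒))
             (runKeys-within 𝕓 (2 + a) (next₂ a) 𝕒 j z<s (s≤s (s≤s le))) (runKeys-within 𝕓 (2 + a) (next₄ a n K) 𝕒 j z<s (s≤s (s≤s le)))))
      (λ a le eq → trans (filterᵇ-finalKeys-𝕓 j a K) (runKeys-within 𝕓 K initialRuns 𝕒 j z<s jK)))))
  where
  j = 2 + s
  bc = λ a n → filterᵇ (inClass 𝕓 (2 + s)) (blockKeys a n K [])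
  fc = λ a → filterᵇ (inClass 𝕓 (2 + s)) (finalKeys a K)
  jK : 2 + s < K
  jK = ≤-trans (s≤s (s≤s (s≤s (m≤m+n s (suc r))))) hK

class-finalB : ∀ K N s → N ≤ s → filterᵇ (inClass 𝕓 (2 + s)) (k₁ 1 0 𝕓 ∷ blocksKeys 0 N K) ≡ filterᵇ (inClass 𝕓 (2 + s)) (runKeys 𝕓 K initialRuns 𝕒)
class-finalB K N s le =
  trans (filterᵇ-blocksKeys (inClass 𝕓 j) 0 N K)
  (trans (cong (catBlocks bc fc 0) (sym (+-identityʳ N)))
  (trans (catBlocks-skip bc fc s (λ a' n' lt → trans (filterᵇ-blockKeys-𝕓 j a' n' K) (cong₂ (λ x y → x ++ y ++ filterᵇ (inClass 𝕓 j) (runKeys 𝕓 1 (next₆ a' n' K) 𝕒))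
             (runKeys-above 𝕓 (2 + a') (next₂ a') 𝕒 j (s≤s (s≤s lt))) (runKeys-above 𝕓 (2 + a') (next₄ a' n' K) 𝕒 j (s≤s (s≤s lt))))) N 0 0 le)
   (filterᵇ-finalKeys-𝕓 j N K)))
  where
  j = 2 + s
  bc = λ a n → filterᵇ (inClass 𝕓 (2 + s)) (blockKeys a n K [])
  fc = λ a → filterᵇ (inClass 𝕓 (2 + s)) (finalKeys a K)

class-sortedB≥2 : ∀ K s r → 3 + (s + suc r) ≤ K → filterᵇ (inClass 𝕓 (2 + s)) (k₁ 1 0 𝕓 ∷ blocksKeys 0 (s + suc r) K) ↭ sortedB≥2 K s r
class-sortedB≥2 K s r hK =
  ↭-trans (↭-reflexive (class-sortedB≥2′ K s r hK))
  (prep Bs (↭-trans (prep Ds (↭-trans (↭-reflexive (catBlocks-const (λ a n → BB a n ++ DD a n) (G ∷ []) (suc s) r)) (++⁺ʳ (G ∷ []) (catUp-unzip BB DD (suc s) r))))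
   (↭-trans (↭-sym (shift Ds (CB ++ CD) (G ∷ [])))
   (↭-trans (↭-reflexive (++-assoc CB CD (Ds ∷ G ∷ [])))
    (++⁺ˡ CB (++⁺ʳ (Ds ∷ G ∷ []) (catUp↭catDown DD (suc s) r)))))))
  where
  j = 2 + s
  BB = λ a (n : ℕ) → k₂ j a 𝕓 ∷ []
  DD = λ a n → k₄ j a n K 𝕓 ∷ []
  CB = catUp BB (suc s) r
  CD = catUp DD (suc s) r
  Bs = k₂ j s 𝕒
  Ds = k₄ j s r K 𝕒
  G = kFinalB j 𝕓

lastLetters-sortedB≥2 : ∀ K s r → map proj₂ (sortedB≥2 K s r) ≡ 𝕒 ∷ 𝕓 ^ᴸ (r + r) ++ 𝕒 ∷ 𝕓 ∷ []
lastLetters-sortedB≥2 K s r = cong (𝕒 ∷_)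
  (trans (map-++ proj₂ (catUp BB (suc s) r) _)
  (trans (cong₂ _++_ (lastLetters-catUp (λ a n → k₂ j a 𝕓) 𝕓 (λ a n → refl) (suc s) r)
     (trans (map-++ proj₂ (catDown DD (suc s) r) _) (cong (_++ 𝕒 ∷ 𝕓 ∷ []) (lastLetters-catDown (λ a n → k₄ j a n K 𝕓) 𝕓 (λ a n → refl) (suc s) r))))
   (trans (sym (++-assoc (𝕓 ^ᴸ r) (𝕓 ^ᴸ r) _)) (cong (_++ 𝕒 ∷ 𝕓 ∷ []) (^ᴸ-++ 𝕓 r r)))))
  where
  j = 2 + s
  BB = λ a (n : ℕ) → k₂ j a 𝕓 ∷ []
  DD = λ a n → k₄ j a n K 𝕓 ∷ []

BelowBlockB : ℕ → ℕ → Key → Set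
BelowBlockB j a z = Σ ℕ λ q → Σ ℕ λ p → Σ (List Run) λ rest → Σ Letter λ l → (z ≡ (((𝕓 , j) ∷ (𝕒 , 3) ∷ (𝕓 , q) ∷ (𝕒 , p) ∷ rest) , l)) × (q < 2 + a) × (1 ≤ p)

chainFrom-sortedB≥2 : ∀ K s r → 1 ≤ K → ∀ z → ShorterB (2 + s) z → ChainFrom z (sortedB≥2 K s r)
chainFrom-sortedB≥2 K s r hK z (j' , p , rest , l , refl , lt , hp) =
  chain∷ (shorter lt refl hp) (ChainFrom-++ Bs CB _ (proj₁ up) (rest-chain r (proj₂ up)))
  where
  j = 2 + s
  BB = λ a (n : ℕ) → k₂ j a 𝕓 ∷ []
  DD = λ a n → k₄ j a n K 𝕓 ∷ []
  CB = catUp BB (suc s) r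
  Bs = k₂ j s 𝕒
  up = ChainFrom-catUp (BelowBlockB j) BB (suc s + r) (λ { a n z _ (q , p , rest , l , refl , lt , hp) → ChainFrom-[-] (same (same (shorter lt refl hp))) , (2 + a , 1 , _ , 𝕓 , refl , ≤-refl , z<s) })
         (suc s) r Bs refl (2 + s , 1 , _ , 𝕒 , refl , ≤-refl , z<s)
  rest-chain : ∀ r {w} → BelowBlockB j (suc s + r) w → ChainFrom w (catDown DD (suc s) r ++ (k₄ j s r K 𝕒 ∷ kFinalB j 𝕓 ∷ []))
  rest-chain zero (q , p , rest , l , refl , lt , hp) = chain∷ (same (longer (s≤s (s≤s z≤n)) refl z<s)) (chain∷ (same (same (shorter (s≤s (s≤s z≤n)) refl z<s))) (chain[-] _))
  rest-chain (suc r) (q , p , rest , l , refl , lt , hp) =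
    ChainFrom-++ _ (catDown DD (suc s) (suc r)) _ (proj₁ down)
      (subst (λ w → ChainFrom w (k₄ j s (suc r) K 𝕒 ∷ kFinalB j 𝕓 ∷ [])) (sym (proj₂ down))
        (chain∷ (same (same (same (longer ≤-refl refl z<s)))) (chain∷ (same (same (shorter (s≤s (s≤s z≤n)) refl z<s))) (chain[-] _))))
    where
    down = ChainFrom-catDown (λ a n → k₄ j a n K 𝕓) (λ _ z → Σ (List Run) λ rest → Σ Letter λ l → z ≡ (((𝕓 , j) ∷ (𝕒 , 3) ∷ rest) , l))
          (λ a n → same (same (same (longer ≤-refl refl z<s)))) (suc s) r _ (_ , _ , refl)
          (λ { b z (rest , l , refl) → same (longer (s≤s (s≤s z≤n)) refl z<s) })

sortedBʲ : ℕ → ℕ → ℕ → List Key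
sortedBʲ t s zero = kFinalB (2 + s) (if (2 + s) ≡ᵇ (7 + t) then 𝕒 else 𝕓) ∷ []
sortedBʲ t s (suc r) = sortedB≥2 (7 + t) s r

sortedA : ℕ → ℕ → List Key
sortedA t zero = []
sortedA t (suc zero) = sortedA1 t (7 + t)
sortedA t (suc (suc zero)) = sortedA2 t (7 + t)
sortedA t (suc (suc (suc zero))) = sortedA3 t (7 + t)
sortedA t (suc (suc (suc (suc s)))) = sortedA≥4 (4 + s) ((4 + t) ∸ (4 + s)) (7 + t)

sortedB : ℕ → ℕ → List Key
sortedB t zero = []
sortedB t (suc zero) = sortedB1 t (7 + t)
sortedB t (suc (suc s)) = sortedBʲ t s ((4 + t) ∸ s)

∸≡suc⇒+ : ∀ m n r → m ∸ n ≡ suc r → n + suc r ≡ m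
∸≡suc⇒+ zero zero r ()
∸≡suc⇒+ zero (suc n) r ()
∸≡suc⇒+ (suc m) zero r eq = sym eq
∸≡suc⇒+ (suc m) (suc n) r eq = cong suc (∸≡suc⇒+ m n r eq)

class-sortedA : ∀ t e → 1 ≤ e → e ≤ 4 + t → filterᵇ (inClass 𝕒 e) (ŵbKeys t) ↭ sortedA t e
class-sortedA t (suc zero) h1 h2 = class-sortedA1 t (7 + t)
class-sortedA t (suc (suc zero)) h1 h2 = ↭-reflexive (class-sortedA2 t (7 + t))
class-sortedA t (suc (suc (suc zero))) h1 h2 = ↭-reflexive (class-sortedA3 t (7 + t))
class-sortedA t (suc (suc (suc (suc s)))) h1 h2 =
  subst (λ n → filterᵇ (inClass 𝕒 (4 + s)) (blocksKeys 0 n (7 + t)) ↭ sortedA≥4 (4 + s) ((4 + t) ∸ (4 + s)) (7 + t)) (m+[n∸m]≡n h2)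
    (↭-reflexive (class-sortedA≥4 (4 + s) ((4 + t) ∸ (4 + s)) (7 + t) (s≤s (s≤s (s≤s (s≤s z≤n))))))

class-finalRunB : ∀ t s → 2 + s ≤ 7 + t → filterᵇ (inClass 𝕓 (2 + s)) (runKeys 𝕓 (7 + t) initialRuns 𝕒) ≡ kFinalB (2 + s) (if (2 + s) ≡ᵇ (7 + t) then 𝕒 else 𝕓) ∷ []
class-finalRunB t s le with m≤n⇒m<n∨m≡n le
... | inj₂ refl = trans (runKeys-top 𝕓 (7 + t) initialRuns 𝕒 z<s) (cong (λ b → kFinalB (7 + t) (if b then 𝕒 else 𝕓) ∷ []) (sym (≡ᵇ-refl (7 + t))))
... | inj₁ lt = trans (runKeys-within 𝕓 (7 + t) initialRuns 𝕒 (2 + s) z<s lt) (cong (λ b → kFinalB (2 + s) (if b then 𝕒 else 𝕓) ∷ []) (sym (<⇒≡ᵇ-false (2 + s) (7 + t) lt)))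

class-sortedB : ∀ t j → 1 ≤ j → j ≤ 7 + t → filterᵇ (inClass 𝕓 j) (ŵbKeys t) ↭ sortedB t j
class-sortedB t (suc zero) h1 h2 = class-sortedB1 t (7 + t) (s≤s (s≤s z≤n))
class-sortedB t (suc (suc s)) h1 h2 = by-gap ((4 + t) ∸ s) refl
  where
  by-gap : ∀ m → (4 + t) ∸ s ≡ m → filterᵇ (inClass 𝕓 (2 + s)) (ŵbKeys t) ↭ sortedBʲ t s m
  by-gap zero eq = ↭-reflexive (trans (class-finalB (7 + t) (4 + t) s (m∸n≡0⇒m≤n eq)) (class-finalRunB t s h2))
  by-gap (suc r) eq = subst (λ n → filterᵇ (inClass 𝕓 (2 + s)) (k₁ 1 0 𝕓 ∷ blocksKeys 0 n (7 + t)) ↭ sortedB≥2 (7 + t) s r) (∸≡suc⇒+ (4 + t) s r eq)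
    (class-sortedB≥2 (7 + t) s r (≤-reflexive (cong (3 +_) (∸≡suc⇒+ (4 + t) s r eq))))

chainFrom-sortedA : ∀ t e → 1 ≤ e → e ≤ 4 + t → ∀ z → LongerA e z → ChainFrom z (sortedA t e)
chainFrom-sortedA t (suc zero) h1 h2 z hz = chainFrom-sortedA1 t (7 + t) refl z hz
chainFrom-sortedA t (suc (suc zero)) h1 h2 z hz = chainFrom-sortedA2 t (7 + t) refl z hz
chainFrom-sortedA t (suc (suc (suc zero))) h1 h2 z hz = chainFrom-sortedA3 t (7 + t) refl z hz
chainFrom-sortedA t (suc (suc (suc (suc s)))) h1 h2 z hz = chainFrom-sortedA≥4 (4 + s) ((4 + t) ∸ (4 + s)) (7 + t) (cong (3 +_) (sym (m+[n∸m]≡n h2))) z hz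

chain-sortedA : ∀ t e → 1 ≤ e → e ≤ 4 + t → Chain (sortedA t e)
chain-sortedA t e h1 h2 = ChainFrom⇒Chain z (sortedA t e) (chainFrom-sortedA t e h1 h2 z (suc e , [] , 𝕒 , refl , ≤-refl))
  where
  z : Key
  z = ((𝕒 , suc e) ∷ []) , 𝕒

chain-sortedB : ∀ t j → 1 ≤ j → j ≤ 7 + t → Chain (sortedB t j)
chain-sortedB t (suc zero) h1 h2 = ChainFrom⇒Chain z (sortedB t 1) (chainFrom-sortedB1 t (7 + t) z<s z (1 , [] , 𝕒 , refl , z<s))
  where
  z : Key
  z = ((𝕒 , 1) ∷ []) , 𝕒
chain-sortedB t (suc (suc s)) h1 h2 = ChainFrom⇒Chain z (sortedB t (2 + s)) (chain ((4 + t) ∸ s))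
  where
  z : Key
  z = ((𝕓 , 0) ∷ (𝕒 , 1) ∷ []) , 𝕒
  chain : ∀ m → ChainFrom z (sortedBʲ t s m)
  chain zero = ChainFrom-[-] (shorter z<s refl z<s)
  chain (suc r) = chainFrom-sortedB≥2 (7 + t) s r z<s z (0 , 1 , [] , 𝕒 , refl , z<s , z<s)

Covered : ℕ → Key → Set
Covered t (((𝕒 , e) ∷ (𝕓 , p) ∷ K) , l) = (1 ≤ e) × (e ≤ 4 + t) × (1 ≤ p)
Covered t (((𝕓 , e) ∷ (𝕒 , p) ∷ K) , l) = (1 ≤ e) × (e ≤ 7 + t) × (1 ≤ p)
Covered t _ = ⊥

Covered⇒WellFormed : ∀ {t} y → Covered t y → WellFormed y
Covered⇒WellFormed (((𝕒 , e) ∷ (𝕓 , p) ∷ K) , l) (1≤e , _ , 1≤p) = 1≤e , refl , 1≤p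
Covered⇒WellFormed (((𝕓 , e) ∷ (𝕒 , p) ∷ K) , l) (1≤e , _ , 1≤p) = 1≤e , refl , 1≤p

runKeys-All : ∀ (P : Key → Set) c m N p → (∀ e l → 1 ≤ e → e ≤ m → P (key c e N l)) → All P (runKeys c m N p)
runKeys-All P c m N p h = applyUpTo⁺₁ _ m (λ {j} j<m → h (m ∸ j) _ (m<n⇒0<n∸m j<m) (m∸n≤m m j))

covered-runKeys𝕒 : ∀ t m {q N} p → m ≤ 4 + t → 1 ≤ q → All (Covered t) (runKeys 𝕒 m ((𝕓 , q) ∷ N) p)
covered-runKeys𝕒 t m p m≤ 1≤q = runKeys-All (Covered t) 𝕒 m _ p (λ e l 1≤e e≤m → 1≤e , ≤-trans e≤m m≤ , 1≤q)

covered-runKeys𝕓 : ∀ t m {q N} p → m ≤ 7 + t → 1 ≤ q → All (Covered t) (runKeys 𝕓 m ((𝕒 , q) ∷ N) p)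
covered-runKeys𝕓 t m p m≤ 1≤q = runKeys-All (Covered t) 𝕓 m _ p (λ e l 1≤e e≤m → 1≤e , ≤-trans e≤m m≤ , 1≤q)

covered-blocksKeys : ∀ t a n → a + n ≡ 4 + t → All (Covered t) (blocksKeys a n (7 + t))
covered-blocksKeys t a zero eq = ++⁺ (covered-runKeys𝕒 t a 𝕓 (≤-reflexive (trans (sym (+-identityʳ a)) eq)) z<s) (covered-runKeys𝕓 t (7 + t) 𝕒 ≤-refl z<s)
covered-blocksKeys t a (suc n) eq =
  ++⁺ (covered-runKeys𝕒 t a 𝕓 a≤ z<s) (++⁺ (covered-runKeys𝕓 t (2 + a) 𝕒 2+a≤ z<s) (++⁺ (covered-runKeys𝕒 t 3 𝕓 (s≤s (s≤s (s≤s z≤n))) z<s)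
   (++⁺ (covered-runKeys𝕓 t (2 + a) 𝕒 2+a≤ z<s) (++⁺ (covered-runKeys𝕒 t 1 𝕓 (s≤s z≤n) z<s) (++⁺ (covered-runKeys𝕓 t 1 𝕒 (s≤s z≤n) z<s)
    (covered-blocksKeys t (suc a) n (trans (sym (+-suc a n)) eq)))))))
  where
  a≤ : a ≤ 4 + t
  a≤ = ≤-trans (m≤m+n a (suc n)) (≤-reflexive eq)
  2+a≤ : 2 + a ≤ 7 + t
  2+a≤ = ≤-trans (s≤s (s≤s a≤)) (n≤1+n _)

covered-ŵbKeys : ∀ t → All (Covered t) (ŵbKeys t)
covered-ŵbKeys t = (s≤s z≤n , s≤s z≤n , s≤s z≤n) ∷ covered-blocksKeys t 0 (4 + t) refl

aPrefix : ℕ → ℕ → Word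
aPrefix t i = 𝕒 ^ᴸ ((4 + t) ∸ i) ++ 𝕓 ∷ []

bPrefix : ℕ → Word
bPrefix i = 𝕓 ^ᴸ (1 + i) ++ 𝕒 ∷ []

classPrefixes : ℕ → List Word
classPrefixes t = applyUpTo (aPrefix t) (4 + t) ++ applyUpTo bPrefix (7 + t)

aᵉb⊏aᵉ′b : ∀ {e e′} → e′ < e → (𝕒 ^ᴸ e ++ 𝕓 ∷ []) ⊏ (𝕒 ^ᴸ e′ ++ 𝕓 ∷ [])
aᵉb⊏aᵉ′b {suc e} {zero} _ = 𝕒⊏𝕓 _ _
aᵉb⊏aᵉ′b {suc e} {suc e′} (s≤s e′<e) = ⊏-cons 𝕒 (aᵉb⊏aᵉ′b e′<e)

bʲa⊏bʲ′a : ∀ {j j′} → j < j′ → (𝕓 ^ᴸ j ++ 𝕒 ∷ []) ⊏ (𝕓 ^ᴸ j′ ++ 𝕒 ∷ [])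
bʲa⊏bʲ′a {zero} {suc j′} _ = 𝕒⊏𝕓 _ _
bʲa⊏bʲ′a {suc j} {suc j′} (s≤s j<j′) = ⊏-cons 𝕓 (bʲa⊏bʲ′a j<j′)

aᵉb⊏bʲa : ∀ {e} j → 1 ≤ e → (𝕒 ^ᴸ e ++ 𝕓 ∷ []) ⊏ (𝕓 ^ᴸ suc j ++ 𝕒 ∷ [])
aᵉb⊏bʲa {suc e} j _ = 𝕒⊏𝕓 _ _

classPrefixes-ordered : ∀ t → AllPairs _⊏_ (classPrefixes t)
classPrefixes-ordered t = AllPairsₚ.++⁺
  (AllPairsₚ.applyUpTo⁺₁ (aPrefix t) (4 + t) (λ i<j j<n → aᵉb⊏aᵉ′b (∸-monoʳ-< i<j (<⇒≤ j<n))))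
  (AllPairsₚ.applyUpTo⁺₁ bPrefix (7 + t) (λ i<j _ → bʲa⊏bʲ′a (s≤s i<j)))
  (applyUpTo⁺₁ (aPrefix t) (4 + t) (λ i<n → applyUpTo⁺₂ bPrefix (7 + t) (λ j → aᵉb⊏bʲa j (m<n⇒0<n∸m i<n))))

key-classPrefix : ∀ t (y : KeyedWord) → Describes y → Covered t (proj₂ y) → HasPrefixIn (classPrefixes t) (proj₁ y)
key-classPrefix t y@(w , ((𝕒 , e) ∷ (𝕓 , p) ∷ K) , l) inv cov@(1≤e , e≤ , _) =
  Anyₚ.++⁺ˡ (Anyₚ.applyUpTo⁺ (aPrefix t) (subst (λ n → isPrefix (𝕒 ^ᴸ n ++ 𝕓 ∷ []) w ≡ true) (sym (m∸[m∸n]≡n e≤)) in-class)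
                                (∸-monoʳ-< 1≤e e≤))
  where
  in-class : isPrefix (𝕒 ^ᴸ e ++ 𝕓 ∷ []) w ≡ true
  in-class = trans (isPrefix-key 𝕒 e y 1≤e inv (Covered⇒WellFormed (proj₂ y) cov)) (≡ᵇ-refl e)
key-classPrefix t y@(w , ((𝕓 , suc i) ∷ (𝕒 , p) ∷ K) , l) inv cov@(1≤e , i< , _) =
  Anyₚ.++⁺ʳ (applyUpTo (aPrefix t) (4 + t)) (Anyₚ.applyUpTo⁺ bPrefix in-class i<)
  where
  in-class : isPrefix (𝕓 ^ᴸ suc i ++ 𝕒 ∷ []) w ≡ true
  in-class = trans (isPrefix-key 𝕓 (suc i) y 1≤e inv (Covered⇒WellFormed (proj₂ y) cov)) (≡ᵇ-refl i)

keyedRotations-ŵb : ∀ t → map proj₂ (keyedRotations (ŵbRuns t) [] 𝕓) ≡ ŵbKeys t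
keyedRotations-ŵb t = trans (keyedRotations-keys (ŵbRuns t) [] 𝕓) (keysOf-ŵbRuns t)

conjugates-covered : ∀ t → All (HasPrefixIn (classPrefixes t)) (conjugates (ŵb (6 + t)))
conjugates-covered t = subst (All (HasPrefixIn (classPrefixes t))) (sym (trans (cong conjugates (ŵb-expand t)) (conjugates-expand (ŵbRuns t) 𝕓)))
  (Allₚ.map⁺ (All.zipWith (λ { {y} (inv , cov) → key-classPrefix t y inv cov })
    (keyedRotations-described (ŵbRuns t) [] 𝕓 (allRuns-positive (3 + t) (7 + t) z<s) (allRuns-precededBy (3 + t) (7 + t) z<s) ,
     map⁻ (subst (All (Covered t)) (sym (keyedRotations-ŵb t)) (covered-ŵbKeys t)))))

ŵbKeys-wellFormed : ∀ t → All WellFormed (map proj₂ (keyedRotations (ŵbRuns t) [] 𝕓))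
ŵbKeys-wellFormed t = subst (All WellFormed) (sym (keyedRotations-ŵb t)) (All.map (λ {y} → Covered⇒WellFormed y) (covered-ŵbKeys t))

β-class𝕒 : ∀ t e → 1 ≤ e → e ≤ 4 + t → β (𝕒 ^ᴸ e ++ 𝕓 ∷ []) (ŵb (6 + t)) ≡ map proj₂ (sortedA t e)
β-class𝕒 t e h1 h2 = trans (cong (β (𝕒 ^ᴸ e ++ 𝕓 ∷ [])) (ŵb-expand t))
  (β-keys (ŵbRuns t) 𝕓 𝕒 e (sortedA t e) (allRuns-positive (3 + t) (7 + t) z<s) (allRuns-precededBy (3 + t) (7 + t) z<s) h1 (ŵbKeys-wellFormed t)
    (subst (λ L → filterᵇ (inClass 𝕒 e) L ↭ sortedA t e) (sym (keyedRotations-ŵb t)) (class-sortedA t e h1 h2)) (chain-sortedA t e h1 h2))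

β-class𝕓 : ∀ t j → 1 ≤ j → j ≤ 7 + t → β (𝕓 ^ᴸ j ++ 𝕒 ∷ []) (ŵb (6 + t)) ≡ map proj₂ (sortedB t j)
β-class𝕓 t j h1 h2 = trans (cong (β (𝕓 ^ᴸ j ++ 𝕒 ∷ [])) (ŵb-expand t))
  (β-keys (ŵbRuns t) 𝕓 𝕓 j (sortedB t j) (allRuns-positive (3 + t) (7 + t) z<s) (allRuns-precededBy (3 + t) (7 + t) z<s) h1 (ŵbKeys-wellFormed t)
    (subst (λ L → filterᵇ (inClass 𝕓 j) L ↭ sortedB t j) (sym (keyedRotations-ŵb t)) (class-sortedB t j h1 h2)) (chain-sortedB t j h1 h2))

prod-applyUpTo : ∀ m n (f : ℕ → Word) → prod m n f ≡ concat (applyUpTo (λ i → f (m + i)) n)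
prod-applyUpTo m zero f = refl
prod-applyUpTo m (suc n) f =
  cong₂ _++_ (cong f (sym (+-identityʳ m)))
    (trans (prod-applyUpTo (suc m) n f) (cong concat (applyUpTo-cong _ _ n (λ i _ → cong f (sym (+-suc m i))))))

concatMap-classPrefixes : ∀ t (g : Word → Word) → concatMap g (classPrefixes t) ≡
  prod 2 (4 + t) (λ i → g ((𝕒 ^ᴸ ((6 + t) ∸ i)) ++ 𝕓 ∷ [])) ++ prod 1 ((6 + t) + 1) (λ i → g ((𝕓 ^ᴸ i) ++ 𝕒 ∷ []))
concatMap-classPrefixes t g =
  begin
    concatMap g (applyUpTo (aPrefix t) (4 + t) ++ applyUpTo bPrefix (7 + t))
  ≡⟨ concatMap-++ g (applyUpTo (aPrefix t) (4 + t)) (applyUpTo bPrefix (7 + t)) ⟩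
    concat (map g (applyUpTo (aPrefix t) (4 + t))) ++ concat (map g (applyUpTo bPrefix (7 + t)))
  ≡⟨ cong₂ _++_ (cong concat (map-applyUpTo (aPrefix t) g (4 + t))) (cong concat (map-applyUpTo bPrefix g (7 + t))) ⟩
    concat (applyUpTo (g ∘ aPrefix t) (4 + t)) ++ concat (applyUpTo (g ∘ bPrefix) (7 + t))
  ≡⟨ cong₂ _++_ (sym (prod-applyUpTo 2 (4 + t) (λ i → g ((𝕒 ^ᴸ ((6 + t) ∸ i)) ++ 𝕓 ∷ []))))
                (trans (sym (prod-applyUpTo 1 (7 + t) (λ i → g ((𝕓 ^ᴸ i) ++ 𝕒 ∷ []))))
                       (cong (λ n → prod 1 n (λ i → g ((𝕓 ^ᴸ i) ++ 𝕒 ∷ []))) (+-comm 1 (6 + t)))) ⟩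
    prod 2 (4 + t) (λ i → g ((𝕒 ^ᴸ ((6 + t) ∸ i)) ++ 𝕓 ∷ [])) ++ prod 1 ((6 + t) + 1) (λ i → g ((𝕓 ^ᴸ i) ++ 𝕒 ∷ []))
  ∎
  where open ≡-Reasoning

BWT-ŵb : ∀ t → BWT (ŵb (6 + t)) ≡ prod 2 (4 + t) (λ i → β ((𝕒 ^ᴸ ((6 + t) ∸ i)) ++ 𝕓 ∷ []) (ŵb (6 + t)))
                  ++ prod 1 ((6 + t) + 1) (λ i → β ((𝕓 ^ᴸ i) ++ 𝕒 ∷ []) (ŵb (6 + t)))
BWT-ŵb t = trans (BWT-classes (ŵb (6 + t)) (classPrefixes t) (classPrefixes-ordered t) (conjugates-covered t))
                  (concatMap-classPrefixes t (λ x → β x (ŵb (6 + t))))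

2*[6+t] : ∀ t → 2 * (6 + t) ≡ 12 + (t + t)
2*[6+t] = solve-∀

2*[x+1+r]∸2*x∸2 : ∀ x r → 2 * (x + suc r) ∸ 2 * x ∸ 2 ≡ r + r
2*[x+1+r]∸2*x∸2 x r =
  trans (∸-+-assoc (2 * (x + suc r)) (2 * x) 2) (trans (cong (_∸ (2 * x + 2)) (distrib x r)) (m+n∸m≡n (2 * x + 2) (r + r)))
  where
  distrib : ∀ x r → 2 * (x + suc r) ≡ (2 * x + 2) + (r + r)
  distrib = solve-∀

β-𝕒ⁱ𝕓 : ∀ t i → 4 ≤ i → i ≤ 4 + t → β ((𝕒 ^ᴸ i) ++ 𝕓 ∷ []) (ŵb (6 + t)) ≡ 𝕓 ∷ (𝕒 ^ᴸ ((6 + t) ∸ i ∸ 2))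
β-𝕒ⁱ𝕓 t (suc (suc (suc (suc s)))) (s≤s (s≤s (s≤s (s≤s _)))) h2 =
  trans (β-class𝕒 t (4 + s) z<s h2) (trans (lastLetters-sortedA≥4 (4 + s) _ (7 + t)) (cong (λ x → 𝕓 ∷ 𝕒 ^ᴸ x) (sym (trans (∸-+-assoc (2 + t) s 2) (cong ((2 + t) ∸_) (+-comm s 2))))))

β-𝕒³𝕓 : ∀ t → β ((𝕒 ^ᴸ 3) ++ 𝕓 ∷ []) (ŵb (6 + t)) ≡ (𝕓 ^ᴸ 5) ++ pow (𝕒 ∷ 𝕓 ∷ []) t ++ 𝕒 ∷ []
β-𝕒³𝕓 t = trans (β-class𝕒 t 3 z<s (s≤s (s≤s (s≤s z≤n)))) (lastLetters-sortedA3 t (7 + t))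

β-𝕒²𝕓 : ∀ t → β ((𝕒 ^ᴸ 2) ++ 𝕓 ∷ []) (ŵb (6 + t)) ≡ 𝕒 ∷ 𝕒 ∷ 𝕓 ∷ (𝕒 ^ᴸ (2 * (6 + t) ∸ 8))
β-𝕒²𝕓 t = trans (β-class𝕒 t 2 z<s (s≤s (s≤s z≤n))) (trans (lastLetters-sortedA2 t (7 + t)) (cong (λ x → 𝕒 ∷ 𝕒 ∷ 𝕓 ∷ 𝕒 ^ᴸ x) (sym (cong (_∸ 8) (2*[6+t] t)))))

β-𝕒𝕓 : ∀ t → β (𝕒 ∷ 𝕓 ∷ []) (ŵb (6 + t)) ≡ (𝕓 ^ᴸ (4 + t)) ++ 𝕓 ∷ 𝕒 ∷ 𝕓 ∷ (𝕒 ^ᴸ (2 * (6 + t) ∸ 6))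
β-𝕒𝕓 t = trans (β-class𝕒 t 1 z<s (s≤s z≤n)) (trans (lastLetters-sortedA1 t (7 + t)) (cong (λ x → 𝕓 ^ᴸ (4 + t) ++ 𝕓 ∷ 𝕒 ∷ 𝕓 ∷ 𝕒 ^ᴸ x) (sym (cong (_∸ 6) (2*[6+t] t)))))

β-𝕓𝕒 : ∀ t → β (𝕓 ∷ 𝕒 ∷ []) (ŵb (6 + t)) ≡ (𝕒 ^ᴸ (1 + t)) ++ 𝕓 ∷ 𝕓 ∷ 𝕓 ∷ 𝕒 ∷ (𝕓 ^ᴸ (1 + t)) ++ 𝕒 ∷ (𝕓 ^ᴸ (4 + t)) ++ 𝕓 ∷ 𝕒 ∷ []
β-𝕓𝕒 t = trans (β-class𝕓 t 1 z<s (s≤s z≤n)) (lastLetters-sortedB1 t (7 + t))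

β-𝕓ʲ𝕒 : ∀ t j → 2 ≤ j → j ≤ 5 + t → β ((𝕓 ^ᴸ j) ++ 𝕒 ∷ []) (ŵb (6 + t)) ≡ 𝕒 ∷ (𝕓 ^ᴸ (2 * (6 + t) ∸ 2 * j ∸ 2)) ++ 𝕒 ∷ 𝕓 ∷ []
β-𝕓ʲ𝕒 t (suc (suc s)) (s≤s (s≤s _)) h2 = trans (β-class𝕓 t (2 + s) z<s (≤-trans h2 (≤-trans (n≤1+n _) (n≤1+n _)))) (by-gap ((4 + t) ∸ s) refl)
  where
  by-gap : ∀ m → (4 + t) ∸ s ≡ m → map proj₂ (sortedBʲ t s m) ≡ 𝕒 ∷ (𝕓 ^ᴸ (2 * (6 + t) ∸ 2 * (2 + s) ∸ 2)) ++ 𝕒 ∷ 𝕓 ∷ []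
  by-gap zero eq = ⊥-elim (<-irrefl refl (≤-trans (m∸n≡0⇒m≤n eq) (≤-pred (≤-pred h2))))
  by-gap (suc r) eq = trans (lastLetters-sortedB≥2 (7 + t) s r) (cong (λ x → 𝕒 ∷ 𝕓 ^ᴸ x ++ 𝕒 ∷ 𝕓 ∷ [])
    (sym (trans (cong (λ x → 2 * x ∸ 2 * (2 + s) ∸ 2) (cong (2 +_) (sym (∸≡suc⇒+ (4 + t) s r eq)))) (2*[x+1+r]∸2*x∸2 (2 + s) r))))

β-𝕓ᵏ𝕒 : ∀ t → β ((𝕓 ^ᴸ (6 + t)) ++ 𝕒 ∷ []) (ŵb (6 + t)) ≡ 𝕓 ∷ []
β-𝕓ᵏ𝕒 t = trans (β-class𝕓 t (6 + t) z<s (n≤1+n _)) (by-gap ((4 + t) ∸ (4 + t)) refl)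
  where
  by-gap : ∀ m → (4 + t) ∸ (4 + t) ≡ m → map proj₂ (sortedBʲ t (4 + t) m) ≡ 𝕓 ∷ []
  by-gap zero eq = cong (λ b → (if b then 𝕒 else 𝕓) ∷ []) (<⇒≡ᵇ-false (6 + t) (7 + t) ≤-refl)
  by-gap (suc r) eq = ⊥-elim (1+n≢0 (trans (sym eq) (n∸n≡0 (4 + t))))

β-𝕓ᵏ⁺¹𝕒 : ∀ t → β ((𝕓 ^ᴸ ((6 + t) + 1)) ++ 𝕒 ∷ []) (ŵb (6 + t)) ≡ 𝕒 ∷ []
β-𝕓ᵏ⁺¹𝕒 t = trans (cong (λ x → β ((𝕓 ^ᴸ x) ++ 𝕒 ∷ []) (ŵb (6 + t))) (+-comm (6 + t) 1))
  (trans (β-class𝕓 t (7 + t) z<s ≤-refl) (by-gap ((4 + t) ∸ (5 + t)) refl))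
  where
  by-gap : ∀ m → (4 + t) ∸ (5 + t) ≡ m → map proj₂ (sortedBʲ t (5 + t) m) ≡ 𝕒 ∷ []
  by-gap zero eq = cong (λ b → (if b then 𝕒 else 𝕓) ∷ []) (≡ᵇ-refl (7 + t))
  by-gap (suc r) eq = ⊥-elim (1+n≢0 (trans (sym eq) (m≤n⇒m∸n≡0 (n≤1+n (4 + t)))))

-- Counting runs

changes : Letter → Word → ℕ
changes p [] = 0
changes p (x ∷ w) = (if p ==ᴸ x then 0 else 1) + changes x w

runs-changes : ∀ x w → runs (x ∷ w) ≡ suc (changes x w)
runs-changes x [] = refl
runs-changes 𝕒 (𝕒 ∷ w) = runs-changes 𝕒 w
runs-changes 𝕒 (𝕓 ∷ w) = cong suc (runs-changes 𝕓 w)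
runs-changes 𝕓 (𝕒 ∷ w) = cong suc (runs-changes 𝕒 w)
runs-changes 𝕓 (𝕓 ∷ w) = runs-changes 𝕓 w

changes-++ : ∀ p u v → changes p (u ++ v) ≡ changes p u + changes (lastOr p u) v
changes-++ p [] v = refl
changes-++ p (x ∷ u) v = trans (cong ((if p ==ᴸ x then 0 else 1) +_) (changes-++ x u v)) (sym (+-assoc (if p ==ᴸ x then 0 else 1) (changes x u) _))

changes-^ᴸ : ∀ c n → changes c (c ^ᴸ n) ≡ 0
changes-^ᴸ 𝕒 zero = refl
changes-^ᴸ 𝕒 (suc n) = changes-^ᴸ 𝕒 n
changes-^ᴸ 𝕓 zero = refl
changes-^ᴸ 𝕓 (suc n) = changes-^ᴸ 𝕓 n

wordA : ℕ → ℕ → Word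
wordA t zero = []
wordA t (suc zero) = 𝕓 ^ᴸ (4 + t) ++ 𝕓 ∷ 𝕒 ∷ 𝕓 ∷ 𝕒 ^ᴸ (6 + (t + t))
wordA t (suc (suc zero)) = 𝕒 ∷ 𝕒 ∷ 𝕓 ∷ 𝕒 ^ᴸ (4 + (t + t))
wordA t (suc (suc (suc zero))) = 𝕓 ^ᴸ 5 ++ pow (𝕒 ∷ 𝕓 ∷ []) t ++ 𝕒 ∷ []
wordA t (suc (suc (suc (suc s)))) = 𝕓 ∷ 𝕒 ^ᴸ (t ∸ s)

lastLetters-sortedA : ∀ t e → map proj₂ (sortedA t e) ≡ wordA t e
lastLetters-sortedA t zero = refl
lastLetters-sortedA t (suc zero) = lastLetters-sortedA1 t (7 + t)
lastLetters-sortedA t (suc (suc zero)) = lastLetters-sortedA2 t (7 + t)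
lastLetters-sortedA t (suc (suc (suc zero))) = lastLetters-sortedA3 t (7 + t)
lastLetters-sortedA t (suc (suc (suc (suc s)))) = lastLetters-sortedA≥4 (4 + s) _ (7 + t)

concatDown : (ℕ → Word) → ℕ → Word
concatDown f zero = []
concatDown f (suc n) = f (suc n) ++ concatDown f n

concatUp : ℕ → ℕ → (ℕ → Word) → Word
concatUp lo zero f = []
concatUp lo (suc n) f = f lo ++ concatUp (suc lo) n f

prod-concatDown : ∀ (g f : ℕ → Word) lo n k → lo + n ≡ k → (∀ e → 1 ≤ e → e ≤ n → g e ≡ f e) →
  prod lo n (λ i → g (k ∸ i)) ≡ concatDown f n
prod-concatDown g f lo zero k eq h = refl
prod-concatDown g f lo (suc n) k eq h =
  cong₂ _++_ (trans (cong g (trans (cong (_∸ lo) (sym eq)) (m+n∸m≡n lo (suc n)))) (h (suc n) z<s ≤-refl))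
             (prod-concatDown g f (suc lo) n k (trans (sym (+-suc lo n)) eq) (λ e h1 h2 → h e h1 (≤-trans h2 (n≤1+n n))))

prod-concatUp : ∀ (g f : ℕ → Word) lo n → (∀ j → lo ≤ j → j < lo + n → g j ≡ f j) → prod lo n g ≡ concatUp lo n f
prod-concatUp g f lo zero h = refl
prod-concatUp g f lo (suc n) h =
  cong₂ _++_ (h lo ≤-refl (≤-trans (s≤s (m≤m+n lo n)) (≤-reflexive (sym (+-suc lo n)))))
             (prod-concatUp g f (suc lo) n (λ j h1 h2 → h j (≤-trans (n≤1+n lo) h1) (≤-trans h2 (≤-reflexive (sym (+-suc lo n))))))

topA : ℕ → ℕ → Word
topA t zero = 𝕓 ∷ 𝕒 ^ᴸ t
topA t (suc n) = (𝕓 ∷ 𝕒 ^ᴸ (t ∸ suc n)) ++ topA t n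

concatDown-topA : ∀ t n → concatDown (wordA t) (4 + n) ≡ topA t n ++ concatDown (wordA t) 3
concatDown-topA t zero = refl
concatDown-topA t (suc n) = trans (cong ((𝕓 ∷ 𝕒 ^ᴸ (t ∸ suc n)) ++_) (concatDown-topA t n)) (sym (++-assoc (𝕓 ∷ 𝕒 ^ᴸ (t ∸ suc n)) (topA t n) _))

δ𝕓 : Letter → ℕ
δ𝕓 p = if p ==ᴸ 𝕓 then 0 else 1

δ𝕒 : Letter → ℕ
δ𝕒 p = if p ==ᴸ 𝕒 then 0 else 1

lastOr-𝕓𝕒ᵐ : ∀ p m → 1 ≤ m → lastOr p (𝕓 ∷ 𝕒 ^ᴸ m) ≡ 𝕒
lastOr-𝕓𝕒ᵐ p m h = lastOr-^ᴸ 𝕓 𝕒 m h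

changes-𝕓𝕒ᵐ : ∀ p m → 1 ≤ m → changes p (𝕓 ∷ 𝕒 ^ᴸ m) ≡ δ𝕓 p + 1
changes-𝕓𝕒ᵐ p (suc m) h = cong (λ x → δ𝕓 p + suc x) (changes-^ᴸ 𝕒 m)

changes-topA : ∀ t n p → n < t → (changes p (topA t n) ≡ δ𝕓 p + suc (n + n)) × (lastOr p (topA t n) ≡ 𝕒)
changes-topA t zero p h = trans (changes-𝕓𝕒ᵐ p t h) refl , lastOr-𝕓𝕒ᵐ p t h
changes-topA t (suc n) p h =
  trans (changes-++ p (𝕓 ∷ 𝕒 ^ᴸ (t ∸ suc n)) (topA t n))
   (trans (cong₂ _+_ (changes-𝕓𝕒ᵐ p (t ∸ suc n) (m<n⇒0<n∸m h)) (trans (cong (λ q → changes q (topA t n)) (lastOr-𝕓𝕒ᵐ p (t ∸ suc n) (m<n⇒0<n∸m h))) (proj₁ ih)))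
    (trans (+-assoc (δ𝕓 p) 1 _) (cong (λ x → δ𝕓 p + suc (suc x)) (sym (+-suc n n))))) ,
  trans (lastOr-++ p (𝕓 ∷ 𝕒 ^ᴸ (t ∸ suc n)) (topA t n)) (proj₂ (changes-topA t n _ (≤-trans (n≤1+n _) h)))
  where
  ih = changes-topA t n 𝕒 (≤-trans (n≤1+n _) h)

changes-[𝕒𝕓]ᵗ𝕒 : ∀ t → (changes 𝕓 (pow (𝕒 ∷ 𝕓 ∷ []) t ++ 𝕒 ∷ []) ≡ suc (t + t)) × (∀ q → lastOr q (pow (𝕒 ∷ 𝕓 ∷ []) t ++ 𝕒 ∷ []) ≡ 𝕒)
changes-[𝕒𝕓]ᵗ𝕒 zero = refl , (λ q → refl)
changes-[𝕒𝕓]ᵗ𝕒 (suc t) = cong (λ x → suc (suc x)) (trans (proj₁ (changes-[𝕒𝕓]ᵗ𝕒 t)) (sym (+-suc t t))) , (λ q → proj₂ (changes-[𝕒𝕓]ᵗ𝕒 t) 𝕓)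

changes-wordA≤3 : ∀ t q → changes q (concatDown (wordA t) 3) ≡ δ𝕓 q + (suc (t + t) + 6)
changes-wordA≤3 t q =
  cong (δ𝕓 q +_) (trans (changes-++ 𝕓 (pow (𝕒 ∷ 𝕓 ∷ []) t ++ 𝕒 ∷ []) _)
    (cong₂ _+_ (proj₁ (changes-[𝕒𝕓]ᵗ𝕒 t)) (trans (cong (λ r → changes r (wordA t 2 ++ wordA t 1 ++ [])) (proj₂ (changes-[𝕒𝕓]ᵗ𝕒 t) 𝕓)) rest)))
  where
  rest : changes 𝕒 (wordA t 2 ++ wordA t 1 ++ []) ≡ 6
  rest = trans (changes-++ 𝕒 (wordA t 2) (wordA t 1 ++ [])) (cong₂ _+_ (cong (2 +_) (changes-^ᴸ 𝕒 (t + t)))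
           (trans (cong (λ r → changes r (wordA t 1 ++ [])) (lastOr-^ᴸ-same 𝕒 (t + t)))
             (trans (changes-++ 𝕒 (wordA t 1) []) (cong (_+ 0) c1))))
    where
    Y : Word
    Y = 𝕓 ∷ 𝕒 ∷ 𝕓 ∷ 𝕒 ^ᴸ (6 + (t + t))
    c1 : changes 𝕒 (wordA t 1) ≡ 4
    c1 = trans (changes-++ 𝕒 (𝕓 ^ᴸ (4 + t)) Y) (cong₂ _+_ (cong suc (changes-^ᴸ 𝕓 t)) (trans (cong (λ r → changes r Y) (lastOr-^ᴸ-same 𝕓 t)) (cong (3 +_) (changes-^ᴸ 𝕒 (t + t)))))

lastOr-wordA≤3 : ∀ t q → lastOr q (concatDown (wordA t) 3) ≡ 𝕒
lastOr-wordA≤3 t q = trans (lastOr-++ q (wordA t 3) (wordA t 2 ++ wordA t 1 ++ [])) (trans (lastOr-++ q3 (wordA t 2) (wordA t 1 ++ [])) (trans (lastOr-++ q2 (wordA t 1) [])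
  (trans (lastOr-++ q2 (𝕓 ^ᴸ (4 + t)) (𝕓 ∷ 𝕒 ∷ 𝕓 ∷ 𝕒 ^ᴸ (6 + (t + t)))) (lastOr-^ᴸ-same 𝕒 (t + t)))))
  where
  q3 = lastOr q (wordA t 3)
  q2 = lastOr q3 (wordA t 2)

changes-wordA : ∀ t → (changes 𝕓 (concatDown (wordA t) (4 + t)) ≡ 7 + (t + t + (t + t))) × (lastOr 𝕓 (concatDown (wordA t) (4 + t)) ≡ 𝕒)
changes-wordA zero = refl , lastOr-wordA≤3 0 𝕓
changes-wordA (suc t) =
  trans (cong (changes 𝕓) (concatDown-topA (suc t) (suc t)))
   (trans (changes-++ 𝕓 (topA (suc t) (suc t)) _)
    (trans (cong₂ _+_ c (trans (cong (λ r → changes r (concatDown (wordA (suc t)) 3)) l) (changes-wordA≤3 (suc t) 𝕒))) (arith t))) ,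
  trans (cong (lastOr 𝕓) (concatDown-topA (suc t) (suc t)))
   (trans (lastOr-++ 𝕓 (topA (suc t) (suc t)) (concatDown (wordA (suc t)) 3)) (lastOr-wordA≤3 (suc t) (lastOr 𝕓 (topA (suc t) (suc t)))))
  where
  eq0 : topA (suc t) (suc t) ≡ 𝕓 ∷ topA (suc t) t
  eq0 = cong (λ m → (𝕓 ∷ 𝕒 ^ᴸ m) ++ topA (suc t) t) (n∸n≡0 t)
  c : changes 𝕓 (topA (suc t) (suc t)) ≡ suc (t + t)
  c = trans (cong (changes 𝕓) eq0) (proj₁ (changes-topA (suc t) t 𝕓 ≤-refl))
  l : lastOr 𝕓 (topA (suc t) (suc t)) ≡ 𝕒
  l = trans (cong (lastOr 𝕓) eq0) (proj₂ (changes-topA (suc t) t 𝕓 ≤-refl))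
  arith : ∀ t → suc (t + t) + (1 + (suc (suc t + suc t) + 6)) ≡ 7 + (suc t + suc t + (suc t + suc t))
  arith = solve-∀

wordB≥2 : ℕ → ℕ → ℕ → Word
wordB≥2 t s zero = (if (2 + s) ≡ᵇ (7 + t) then 𝕒 else 𝕓) ∷ []
wordB≥2 t s (suc r) = 𝕒 ∷ 𝕓 ^ᴸ (r + r) ++ 𝕒 ∷ 𝕓 ∷ []

wordB : ℕ → ℕ → Word
wordB t zero = []
wordB t (suc zero) = 𝕒 ^ᴸ (1 + t) ++ 𝕓 ∷ 𝕓 ∷ 𝕓 ∷ 𝕒 ∷ 𝕓 ^ᴸ (1 + t) ++ 𝕒 ∷ 𝕓 ^ᴸ (4 + t) ++ 𝕓 ∷ 𝕒 ∷ []
wordB t (suc (suc s)) = wordB≥2 t s ((4 + t) ∸ s)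

lastLetters-sortedB : ∀ t j → map proj₂ (sortedB t j) ≡ wordB t j
lastLetters-sortedB t zero = refl
lastLetters-sortedB t (suc zero) = lastLetters-sortedB1 t (7 + t)
lastLetters-sortedB t (suc (suc s)) = by-gap ((4 + t) ∸ s)
  where
  by-gap : ∀ m → map proj₂ (sortedBʲ t s m) ≡ wordB≥2 t s m
  by-gap zero = refl
  by-gap (suc r) = lastLetters-sortedB≥2 (7 + t) s r

changes-wordB1 : ∀ t → (changes 𝕒 (wordB t 1) ≡ 6) × (lastOr 𝕒 (wordB t 1) ≡ 𝕒)
changes-wordB1 t = c0 , l0
  where
  Z' : Word
  Z' = 𝕓 ∷ 𝕒 ∷ []
  Z : Word
  Z = 𝕒 ∷ 𝕓 ^ᴸ (4 + t) ++ Z'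
  Y : Word
  Y = 𝕓 ∷ 𝕓 ∷ 𝕓 ∷ 𝕒 ∷ 𝕓 ^ᴸ (1 + t) ++ Z
  cZ' : changes 𝕓 (𝕓 ^ᴸ t ++ Z') ≡ 1
  cZ' = trans (changes-++ 𝕓 (𝕓 ^ᴸ t) Z') (cong₂ _+_ (changes-^ᴸ 𝕓 t) (cong (λ r → changes r Z') (lastOr-^ᴸ-same 𝕓 t)))
  cZ : changes 𝕓 Z ≡ 3
  cZ = cong (2 +_) cZ'
  cY : changes 𝕒 Y ≡ 6
  cY = cong (3 +_) (trans (changes-++ 𝕓 (𝕓 ^ᴸ t) Z) (cong₂ _+_ (changes-^ᴸ 𝕓 t) (trans (cong (λ r → changes r Z) (lastOr-^ᴸ-same 𝕓 t)) cZ)))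
  c0 : changes 𝕒 (wordB t 1) ≡ 6
  c0 = trans (changes-++ 𝕒 (𝕒 ^ᴸ t) Y) (cong₂ _+_ (changes-^ᴸ 𝕒 t) (trans (cong (λ r → changes r Y) (lastOr-^ᴸ-same 𝕒 t)) cY))
  l0 : lastOr 𝕒 (wordB t 1) ≡ 𝕒
  l0 = trans (lastOr-++ 𝕒 (𝕒 ^ᴸ t) Y) (trans (lastOr-++ _ (𝕓 ^ᴸ t) Z) (trans (lastOr-++ _ (𝕓 ^ᴸ t) Z') refl))

wordB≥2-value : ∀ t s n → s + suc n ≡ 4 + t → wordB t (2 + s) ≡ 𝕒 ∷ 𝕓 ^ᴸ (n + n) ++ 𝕒 ∷ 𝕓 ∷ []
wordB≥2-value t s n eq = cong (wordB≥2 t s) (trans (cong (_∸ s) (sym eq)) (m+n∸m≡n s (suc n)))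

changes-𝕒𝕓ⁿ𝕒𝕓 : ∀ p n → (changes p (𝕒 ∷ 𝕓 ^ᴸ (suc n + suc n) ++ 𝕒 ∷ 𝕓 ∷ []) ≡ δ𝕒 p + 3) × (lastOr p (𝕒 ∷ 𝕓 ^ᴸ (suc n + suc n) ++ 𝕒 ∷ 𝕓 ∷ []) ≡ 𝕓)
changes-𝕒𝕓ⁿ𝕒𝕓 p n = cong (λ x → δ𝕒 p + suc x) (trans (changes-++ 𝕓 (𝕓 ^ᴸ (n + suc n)) (𝕒 ∷ 𝕓 ∷ [])) (cong₂ _+_ (changes-^ᴸ 𝕓 (n + suc n)) (cong (λ r → changes r (𝕒 ∷ 𝕓 ∷ [])) (lastOr-^ᴸ-same 𝕓 (n + suc n))))) ,
  lastOr-++ 𝕒 (𝕓 ^ᴸ suc (n + suc n)) (𝕒 ∷ 𝕓 ∷ [])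

changes-wordB-middle : ∀ t s n → s + suc n ≡ 4 + t → ∀ p → (changes p (concatUp (2 + s) (suc n) (wordB t)) ≡ δ𝕒 p + suc ((n + n) + (n + n))) × (lastOr p (concatUp (2 + s) (suc n) (wordB t)) ≡ 𝕓)
changes-wordB-middle t s zero eq p rewrite wordB≥2-value t s zero eq = refl , refl
changes-wordB-middle t s (suc n) eq p rewrite wordB≥2-value t s (suc n) eq =
  trans (changes-++ p W _) (trans (cong₂ _+_ (proj₁ (changes-𝕒𝕓ⁿ𝕒𝕓 p n)) (trans (cong (λ r → changes r (concatUp (3 + s) (suc n) (wordB t))) (proj₂ (changes-𝕒𝕓ⁿ𝕒𝕓 p n))) (proj₁ ih))) (arith (δ𝕒 p) n)) ,
  trans (lastOr-++ p W _) (trans (cong (λ r → lastOr r (concatUp (3 + s) (suc n) (wordB t))) (proj₂ (changes-𝕒𝕓ⁿ𝕒𝕓 p n))) (proj₂ ih))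
  where
  W = 𝕒 ∷ 𝕓 ^ᴸ (suc n + suc n) ++ 𝕒 ∷ 𝕓 ∷ []
  ih = changes-wordB-middle t (suc s) n (trans (sym (+-suc s (suc n))) eq) 𝕓
  arith : ∀ d n → d + 3 + (1 + suc (n + n + (n + n))) ≡ d + suc (suc n + suc n + (suc n + suc n))
  arith = solve-∀

concatUp-+ : ∀ f lo m n → concatUp lo (m + n) f ≡ concatUp lo m f ++ concatUp (lo + m) n f
concatUp-+ f lo zero n = cong (λ x → concatUp x n f) (sym (+-identityʳ lo))
concatUp-+ f lo (suc m) n = trans (cong (f lo ++_) (trans (concatUp-+ f (suc lo) m n) (cong (λ x → concatUp (suc lo) m f ++ concatUp x n f) (sym (+-suc lo m)))))
  (sym (++-assoc (f lo) _ _))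

wordB-k : ∀ t → wordB t (6 + t) ≡ 𝕓 ∷ []
wordB-k t = by-gap ((4 + t) ∸ (4 + t)) refl
  where
  by-gap : ∀ m → (4 + t) ∸ (4 + t) ≡ m → wordB≥2 t (4 + t) m ≡ 𝕓 ∷ []
  by-gap zero eq = cong (λ b → (if b then 𝕒 else 𝕓) ∷ []) (<⇒≡ᵇ-false (6 + t) (7 + t) ≤-refl)
  by-gap (suc r) eq = ⊥-elim (1+n≢0 (trans (sym eq) (n∸n≡0 (4 + t))))

wordB-k+1 : ∀ t → wordB t (7 + t) ≡ 𝕒 ∷ []
wordB-k+1 t = by-gap ((4 + t) ∸ (5 + t)) refl
  where
  by-gap : ∀ m → (4 + t) ∸ (5 + t) ≡ m → wordB≥2 t (5 + t) m ≡ 𝕒 ∷ []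
  by-gap zero eq = cong (λ b → (if b then 𝕒 else 𝕓) ∷ []) (≡ᵇ-refl (7 + t))
  by-gap (suc r) eq = ⊥-elim (1+n≢0 (trans (sym eq) (m≤n⇒m∸n≡0 (n≤1+n (4 + t)))))

changes-wordB : ∀ t → changes 𝕒 (concatUp 1 (7 + t) (wordB t)) ≡ 20 + ((t + t) + (t + t))
changes-wordB t =
  trans (changes-++ 𝕒 (wordB t 1) _)
  (trans (cong₂ _+_ (proj₁ (changes-wordB1 t)) (trans (cong (λ r → changes r (concatUp 2 (6 + t) (wordB t))) (proj₂ (changes-wordB1 t)))
    (trans (cong (changes 𝕒) (trans (cong (λ n → concatUp 2 n (wordB t)) (+-comm 2 (4 + t))) (concatUp-+ (wordB t) 2 (4 + t) 2)))
     (trans (changes-++ 𝕒 (concatUp 2 (4 + t) (wordB t)) _)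
      (cong₂ _+_ (proj₁ (changes-wordB-middle t 0 (3 + t) refl 𝕒))
        (trans (cong (λ r → changes r (concatUp (2 + (4 + t)) 2 (wordB t))) (proj₂ (changes-wordB-middle t 0 (3 + t) refl 𝕒)))
          (cong₂ (λ x y → changes 𝕓 (x ++ y ++ [])) (wordB-k t) (wordB-k+1 t))))))))
   (arith t))
  where
  arith : ∀ t → 6 + (0 + suc (3 + t + (3 + t) + (3 + t + (3 + t))) + 1) ≡ 20 + (t + t + (t + t))
  arith = solve-∀

BWT-ŵb-words : ∀ t → BWT (ŵb (6 + t)) ≡ concatDown (wordA t) (4 + t) ++ concatUp 1 (7 + t) (wordB t)
BWT-ŵb-words t =
  trans (BWT-ŵb t)
    (cong₂ _++_ (prod-concatDown (λ e → β (𝕒 ^ᴸ e ++ 𝕓 ∷ []) (ŵb (6 + t))) (wordA t) 2 (4 + t) (6 + t) refl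
                  (λ e h1 h2 → trans (β-class𝕒 t e h1 h2) (lastLetters-sortedA t e)))
      (trans (cong (λ n → prod 1 n (λ j → β (𝕓 ^ᴸ j ++ 𝕒 ∷ []) (ŵb (6 + t)))) (+-comm (6 + t) 1))
        (prod-concatUp (λ j → β (𝕓 ^ᴸ j ++ 𝕒 ∷ []) (ŵb (6 + t))) (wordB t) 1 (7 + t)
          (λ j h1 h2 → trans (β-class𝕓 t j h1 (≤-pred h2)) (lastLetters-sortedB t j)))))

r-ŵb : ∀ t → r (ŵb (6 + t)) ≡ 8 * (6 + t) ∸ 20
r-ŵb t =
  begin
    runs (BWT (ŵb (6 + t)))
  ≡⟨ cong runs (BWT-ŵb-words t) ⟩
    runs (A ++ B)
  ≡⟨ runs-changes 𝕓 ((𝕒 ^ᴸ (t ∸ t) ++ concatDown (wordA t) (3 + t)) ++ B) ⟩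
    suc (changes 𝕓 (A ++ B))
  ≡⟨ cong suc (changes-++ 𝕓 A B) ⟩
    suc (changes 𝕓 A + changes (lastOr 𝕓 A) B)
  ≡⟨ cong suc (cong₂ _+_ (proj₁ (changes-wordA t)) (trans (cong (λ q → changes q B) (proj₂ (changes-wordA t))) (changes-wordB t))) ⟩
    suc (7 + (t + t + (t + t)) + (20 + (t + t + (t + t))))
  ≡⟨ sym (trans (cong (_∸ 20) (total t)) (m+n∸m≡n 20 _)) ⟩
    8 * (6 + t) ∸ 20
  ∎
  where
  open ≡-Reasoning
  A = concatDown (wordA t) (4 + t)
  B = concatUp 1 (7 + t) (wordB t)
  total : ∀ t → 8 * (6 + t) ≡ 20 + suc (7 + (t + t + (t + t)) + (20 + (t + t + (t + t))))
  total = solve-∀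

lemma20 : (k : ℕ) → 5 < k →
  ((i : ℕ) → 4 ≤ i → i ≤ k ∸ 2 →
     β ((𝕒 ^ᴸ i) ++ 𝕓 ∷ []) (ŵb k) ≡ 𝕓 ∷ (𝕒 ^ᴸ (k ∸ i ∸ 2)))
  × β ((𝕒 ^ᴸ 3) ++ 𝕓 ∷ []) (ŵb k) ≡ (𝕓 ^ᴸ 5) ++ pow (𝕒 ∷ 𝕓 ∷ []) (k ∸ 6) ++ 𝕒 ∷ []
  × β ((𝕒 ^ᴸ 2) ++ 𝕓 ∷ []) (ŵb k) ≡ 𝕒 ∷ 𝕒 ∷ 𝕓 ∷ (𝕒 ^ᴸ (2 * k ∸ 8))
  × β (𝕒 ∷ 𝕓 ∷ []) (ŵb k) ≡ (𝕓 ^ᴸ (k ∸ 2)) ++ 𝕓 ∷ 𝕒 ∷ 𝕓 ∷ (𝕒 ^ᴸ (2 * k ∸ 6))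
  × β (𝕓 ∷ 𝕒 ∷ []) (ŵb k) ≡ (𝕒 ^ᴸ (k ∸ 5)) ++ 𝕓 ∷ 𝕓 ∷ 𝕓 ∷ 𝕒 ∷ (𝕓 ^ᴸ (k ∸ 5))
                              ++ 𝕒 ∷ (𝕓 ^ᴸ (k ∸ 2)) ++ 𝕓 ∷ 𝕒 ∷ []
  × ((j : ℕ) → 2 ≤ j → j ≤ k ∸ 1 →
     β ((𝕓 ^ᴸ j) ++ 𝕒 ∷ []) (ŵb k) ≡ 𝕒 ∷ (𝕓 ^ᴸ (2 * k ∸ 2 * j ∸ 2)) ++ 𝕒 ∷ 𝕓 ∷ [])
  × β ((𝕓 ^ᴸ k) ++ 𝕒 ∷ []) (ŵb k) ≡ 𝕓 ∷ []
  × β ((𝕓 ^ᴸ (k + 1)) ++ 𝕒 ∷ []) (ŵb k) ≡ 𝕒 ∷ []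
  × BWT (ŵb k) ≡ prod 2 (k ∸ 2) (λ i → β ((𝕒 ^ᴸ (k ∸ i)) ++ 𝕓 ∷ []) (ŵb k))
                 ++ prod 1 (k + 1) (λ i → β ((𝕓 ^ᴸ i) ++ 𝕒 ∷ []) (ŵb k))
  × r (ŵb k) ≡ 8 * k ∸ 20
lemma20 (suc (suc (suc (suc (suc (suc t)))))) (s≤s (s≤s (s≤s (s≤s (s≤s (s≤s z≤n)))))) =
  β-𝕒ⁱ𝕓 t , β-𝕒³𝕓 t , β-𝕒²𝕓 t , β-𝕒𝕓 t , β-𝕓𝕒 t , β-𝕓ʲ𝕒 t , β-𝕓ᵏ𝕒 t , β-𝕓ᵏ⁺¹𝕒 t , BWT-ŵb t , r-ŵb t
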